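{- For the $5$-dimensional hypercube graph $Q_5$, $\mathrm{sn}(Q_5)=\mathrm{gon}(Q_5)=16$.
   Context: $Q_n$ has vertex set $\{0,1\}^n$, two vertices adjacent iff they differ in exactly one coordinate. A scramble on $G$ is a collection $\mathcal{S}$ of nonempty vertex sets each inducing a connected subgraph (eggs); $h(\mathcal{S})$ is the minimum size of a set meeting every egg; an egg-cut is $A\subseteq V(G)$ with both $A$ and $A^C$ containing an egg, of size $|E(A,A^C)|$; $e(\mathcal{S})$ is the minimum size of an egg-cut ($\infty$ if none); the order is $\min(h(\mathcal{S}),e(\mathcal{S}))$; $\mathrm{sn}(G)$ is the maximum order of a scramble. A divisor is $D:V(G)\to\mathbb{Z}$, of degree $\sum_vD(v)$, effective if nonnegative; firing $v$ subtracts $\mathrm{val}(v)$ from $D(v)$ and adds the number of edges $vw$ to each $D(w)$, $w\ne v$; equivalence is via finite sequences of firings. $\mathrm{gon}(G)$ is the minimum degree of a divisor $D$ such that for every vertex $q$, $D$ minus one chip at $q$ is equivalent to an effective divisor. -}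

module Defs where

open import Data.Bool using (Bool; true; false; if_then_else_; _∧_; not)
open import Data.Nat using (ℕ; zero; suc; _≤_; _≡ᵇ_)
open import Data.Integer using (ℤ; +_; _-_; _+_) renaming (_≤_ to _≤ℤ_)
open import Data.List using (List; []; _∷_; map; _++_; foldr)
open import Data.Nat.ListAction using (sum)
open import Data.Vec using (Vec; []; _∷_)
open import Data.Vec.Properties using (≡-dec)
import Data.Bool.Properties as BoolP
open import Data.Product using (Σ; ∃; _×_; _,_)
open import Relation.Binary.PropositionalEquality using (_≡_)
open import Relation.Nullary using (¬_; does)
open import Relation.Binary.Construct.Closure.ReflexiveTransitive using (Star)

V : ℕ → Set
V n = Vec Bool n

allV : (n : ℕ) → List (V n)
allV zero    = [] ∷ []
allV (suc n) = map (false ∷_) (allV n) ++ map (true ∷_) (allV n)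

hamming : {n : ℕ} → V n → V n → ℕ
hamming []       []       = zero
hamming (x ∷ u) (y ∷ v) = (if does (x BoolP.≟ y) then 0 else 1) Data.Nat.+ hamming u v

adj : {n : ℕ} → V n → V n → Bool
adj u v = hamming u v ≡ᵇ 1

_≟V_ : {n : ℕ} → V n → V n → Bool
u ≟V v = does (≡-dec BoolP._≟_ u v)

count : {A : Set} → (A → Bool) → List A → ℕ
count f xs = sum (map (λ x → if f x then 1 else 0) xs)

VSet : ℕ → Set
VSet n = V n → Bool

size : {n : ℕ} → VSet n → ℕ
size {n} S = count S (allV n)

_⊆_ : {n : ℕ} → VSet n → VSet n → Set
S ⊆ T = ∀ v → S v ≡ true → T v ≡ true

compl : {n : ℕ} → VSet n → VSet n
compl S v = not (S v)

val : {n : ℕ} → V n → ℕ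
val {n} v = count (adj v) (allV n)

cutSize : {n : ℕ} → VSet n → ℕ
cutSize {n} A = sum (map (λ u → count (λ w → A u ∧ not (A w) ∧ adj u w) (allV n)) (allV n))

data WalkIn {n : ℕ} (S : VSet n) : V n → V n → Set where
  stop : ∀ {v} → S v ≡ true → WalkIn S v v
  step : ∀ {u w v} → S u ≡ true → adj u w ≡ true → WalkIn S w v → WalkIn S u v

Nonempty : {n : ℕ} → VSet n → Set
Nonempty S = ∃ λ v → S v ≡ true

InducesConnected : {n : ℕ} → VSet n → Set
InducesConnected S = ∀ u v → S u ≡ true → S v ≡ true → WalkIn S u v

record Scramble (n : ℕ) : Set₁ where
  field
    Egg          : VSet n → Set
    eggNonempty  : ∀ E → Egg E → Nonempty E
    eggConnected : ∀ E → Egg E → InducesConnected E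
open Scramble public

Hits : {n : ℕ} → Scramble n → VSet n → Set
Hits S C = ∀ E → Egg S E → ∃ λ v → C v ≡ true × E v ≡ true

EggCut : {n : ℕ} → Scramble n → VSet n → Set
EggCut S A = (∃ λ E → Egg S E × E ⊆ A) × (∃ λ E → Egg S E × E ⊆ compl A)

-- order(S) = min(h(S), e(S)) ≥ k  iff  h(S) ≥ k and e(S) ≥ k
OrderAtLeast : {n : ℕ} → Scramble n → ℕ → Set
OrderAtLeast S k = (∀ C → Hits S C → k ≤ size C) × (∀ A → EggCut S A → k ≤ cutSize A)

ScrambleNumberIs : ℕ → ℕ → Set₁
ScrambleNumberIs n k = (Σ (Scramble n) λ S → OrderAtLeast S k) × (∀ (S : Scramble n) → ¬ OrderAtLeast S (suc k))

Divisor : ℕ → Set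
Divisor n = V n → ℤ

deg : {n : ℕ} → Divisor n → ℤ
deg {n} D = foldr _+_ (+ 0) (map D (allV n))

Effective : {n : ℕ} → Divisor n → Set
Effective D = ∀ v → + 0 ≤ℤ D v

fire : {n : ℕ} → V n → Divisor n → Divisor n
fire v D w = if w ≟V v then D w - + val v
             else D w + (if adj v w then + 1 else + 0)

Fires : {n : ℕ} → Divisor n → Divisor n → Set
Fires D D' = ∃ λ v → ∀ w → D' w ≡ fire v D w

_∼_ : {n : ℕ} → Divisor n → Divisor n → Set
_∼_ = Star Fires

minusChip : {n : ℕ} → Divisor n → V n → Divisor n
minusChip D q w = if w ≟V q then D w - + 1 else D w

PositiveRank : {n : ℕ} → Divisor n → Set
PositiveRank D = ∀ q → ∃ λ E → Effective E × (minusChip D q ∼ E)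

GonalityIs : ℕ → ℕ → Set
GonalityIs n k = (Σ (Divisor n) λ D → PositiveRank D × deg D ≡ + k)
               × (∀ (D : Divisor n) → PositiveRank D → + k ≤ℤ deg D)

-- Scramble number is at most gonality on every graph. Take a scramble of order k and a divisor D of
-- positive rank with deg D < k; for each q some divisor Y q ~ D is effective with a chip on q.
-- Starting from one of them, move an effective X ~ D towards each Y q in turn by firing the part of
-- the script from X to Y q that lies above a level t chosen so that no egg lies strictly above or
-- strictly below t; such a level exists because otherwise an egg-cut of size at most deg D < k would
-- appear. Eggs without chips after the move had none before and have none in Y q. At the end the
-- support of X has at most deg D < k vertices, so it misses some egg E, which is then chipless in
-- every Y q, contradicting the chip of Y q on q for q in E.
--
-- On Q₅ one chip on each even vertex has degree 16 and positive rank (an odd q is reached by firing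
-- every other vertex), so gon(Q₅) ≤ 16 and sn(Q₅) ≤ 16. Conversely, the connected sets of at least
-- six vertices and the stars with four leaves form a scramble of order 16: Harper's
-- edge-isoperimetric inequality bounds egg-cuts from below by 16, and every 17 vertices contain an
-- egg, which is checked by computation on the subcubes of dimension 3 and 4.

module Submission where

open import Defs
open import Data.Bool using (Bool; true; false; if_then_else_; _∧_; _∨_; not; _xor_; T)
import Data.Bool.Properties as BoolP
open import Data.Bool.ListAction using (all; any; and; or)
open import Data.Empty using (⊥; ⊥-elim)
open import Data.Integer as ℤ using (ℤ; +_; +0; -_; _-_; _+_; _⊓_; _⊔_) renaming (_≤_ to _≤ℤ_; _<_ to _<ℤ_)
import Data.Integer.Properties as ℤP
open import Data.Integer.Tactic.RingSolver using (solve-∀)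
open import Data.List using (List; []; _∷_; map; _++_; foldr; length; drop; head; concatMap; cartesianProduct; findᵇ; filterᵇ)
import Data.List.Properties as ListP
open import Data.List.Membership.Propositional using (_∈_; find)
import Data.List.Membership.Propositional.Properties as ∈P
import Data.List.Relation.Unary.All as All
open import Data.List.Relation.Unary.All.Properties using (all⁺)
open import Data.List.Relation.Unary.Any as Any using (here; there)
open import Data.List.Relation.Unary.Any.Properties using (any⁺; any⁻)
open import Data.Maybe using (Maybe; just; nothing; fromMaybe)
open import Data.Nat as ℕ using (ℕ; zero; suc; _≤_; _<_; z≤n; s≤s; _≤ᵇ_; _≡ᵇ_; _<ᵇ_; _^_; _*_; _∸_)
import Data.Nat.Properties as ℕP
open import Data.Nat.ListAction using (sum)
open import Data.Product using (Σ; ∃; ∃₂; _×_; _,_; proj₁; proj₂)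
open import Data.Sum using (_⊎_; inj₁; inj₂)
open import Data.Unit using (tt)
open import Data.Vec using ([]; _∷_; replicate)
open import Function using (_∘_)
open import Relation.Binary.PropositionalEquality
open import Relation.Binary.Construct.Closure.ReflexiveTransitive using (ε; _◅_)
open import Relation.Nullary using (¬_; does; yes; no; Dec)
open import Relation.Nullary.Decidable using (dec-false; ¬¬-excluded-middle; from-yes; _→-dec_)

∧-true : {a b : Bool} → (a ∧ b) ≡ true → a ≡ true × b ≡ true
∧-true {true} {true} _ = refl , refl

∨-true : {a b : Bool} → (a ∨ b) ≡ true → (a ≡ true) ⊎ (b ≡ true)
∨-true {true} _ = inj₁ refl
∨-true {false} e = inj₂ e

T⇒≡ : ∀ {b} → T b → b ≡ true
T⇒≡ {true} _ = refl

≡⇒T : ∀ {b} → b ≡ true → T b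
≡⇒T refl = tt

does⇒ : {P : Set} (p? : Dec P) → does p? ≡ true → P
does⇒ (yes p) _ = p

all-sound : {A : Set} (p : A → Bool) (xs : List A) → T (all p xs) → ∀ {x} → x ∈ xs → p x ≡ true
all-sound p xs ok x∈xs = T⇒≡ (All.lookup (all⁺ p xs ok) x∈xs)

<ᵇ⇒< : ∀ {m n} → (m <ᵇ n) ≡ true → m < n
<ᵇ⇒< {m} {n} e = ℕP.<ᵇ⇒< m n (≡⇒T e)

∑ : {A : Set} → List A → (A → ℤ) → ℤ
∑ xs f = foldr _+_ +0 (map f xs)

module _ {A : Set} where

  ∑-++ : (xs ys : List A) (f : A → ℤ) → ∑ (xs ++ ys) f ≡ ∑ xs f + ∑ ys f
  ∑-++ [] ys f = sym (ℤP.+-identityˡ _)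
  ∑-++ (x ∷ xs) ys f rewrite ∑-++ xs ys f = sym (ℤP.+-assoc (f x) _ _)

  ∑-cong : (xs : List A) {f g : A → ℤ} → (∀ x → f x ≡ g x) → ∑ xs f ≡ ∑ xs g
  ∑-cong [] eq = refl
  ∑-cong (x ∷ xs) eq = cong₂ _+_ (eq x) (∑-cong xs eq)

  ∑-+ : (xs : List A) (f g : A → ℤ) → ∑ xs (λ x → f x + g x) ≡ ∑ xs f + ∑ xs g
  ∑-+ [] f g = refl
  ∑-+ (x ∷ xs) f g rewrite ∑-+ xs f g = interchange (f x) (g x) (∑ xs f) (∑ xs g)
    where
    interchange : ∀ a b c d → (a + b) + (c + d) ≡ (a + c) + (b + d)
    interchange = solve-∀

  ∑-neg : (xs : List A) (f : A → ℤ) → ∑ xs (λ x → - f x) ≡ - ∑ xs f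
  ∑-neg [] f = refl
  ∑-neg (x ∷ xs) f rewrite ∑-neg xs f = sym (ℤP.neg-distrib-+ (f x) _)

  ∑-zero : (xs : List A) → ∑ xs (λ _ → +0) ≡ +0
  ∑-zero [] = refl
  ∑-zero (x ∷ xs) = trans (ℤP.+-identityˡ _) (∑-zero xs)

  ∑-mono : (xs : List A) {f g : A → ℤ} → (∀ x → f x ≤ℤ g x) → ∑ xs f ≤ℤ ∑ xs g
  ∑-mono [] le = ℤP.≤-refl
  ∑-mono (x ∷ xs) le = ℤP.+-mono-≤ (le x) (∑-mono xs le)

  ∑-nonneg : (xs : List A) {f : A → ℤ} → (∀ x → +0 ≤ℤ f x) → +0 ≤ℤ ∑ xs f
  ∑-nonneg xs {f} nn = subst (_≤ℤ ∑ xs f) (∑-zero xs) (∑-mono xs nn)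

  term≤∑ : (xs : List A) {f : A → ℤ} → (∀ x → +0 ≤ℤ f x) → ∀ {y} → y ∈ xs → f y ≤ℤ ∑ xs f
  term≤∑ (x ∷ xs) nn (here refl) = ℤP.i≤i+j _ _ {{ℤ.nonNegative (∑-nonneg xs nn)}}
  term≤∑ (x ∷ xs) nn (there y∈xs) = ℤP.i≤j⇒i≤k+j _ {{ℤ.nonNegative (nn x)}} (term≤∑ xs nn y∈xs)

  ∑-filterᵇ : (p : A → Bool) (xs : List A) (f : A → ℤ) → ∑ (filterᵇ p xs) f ≡ ∑ xs (λ x → if p x then f x else +0)
  ∑-filterᵇ p [] f = refl
  ∑-filterᵇ p (x ∷ xs) f with p x
  ... | true = cong (_+_ (f x)) (∑-filterᵇ p xs f)
  ... | false = trans (∑-filterᵇ p xs f) (sym (ℤP.+-identityˡ _))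

module _ {A B : Set} where

  ∑-map : (g : A → B) (xs : List A) (f : B → ℤ) → ∑ (map g xs) f ≡ ∑ xs (λ x → f (g x))
  ∑-map g [] f = refl
  ∑-map g (x ∷ xs) f = cong (_+_ (f (g x))) (∑-map g xs f)

  ∑-swap : (xs : List A) (ys : List B) (F : A → B → ℤ) →
           ∑ xs (λ x → ∑ ys (F x)) ≡ ∑ ys (λ y → ∑ xs (λ x → F x y))
  ∑-swap [] ys F = sym (∑-zero ys)
  ∑-swap (x ∷ xs) ys F rewrite ∑-swap xs ys F = sym (∑-+ ys (F x) (λ y → ∑ xs (λ x → F x y)))

∑V : {n : ℕ} → (V n → ℤ) → ℤ
∑V {n} = ∑ (allV n)

∑V-halves : {n : ℕ} (f : V (suc n) → ℤ) → ∑V f ≡ ∑V (λ u → f (false ∷ u)) + ∑V (λ u → f (true ∷ u))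
∑V-halves {n} f = trans (∑-++ (map (false ∷_) (allV n)) _ f)
  (cong₂ _+_ (∑-map (false ∷_) (allV n) f) (∑-map (true ∷_) (allV n) f))

∈allV : {n : ℕ} (v : V n) → v ∈ allV n
∈allV [] = here refl
∈allV {suc n} (false ∷ v) = ∈P.∈-++⁺ˡ (∈P.∈-map⁺ (false ∷_) (∈allV v))
∈allV {suc n} (true ∷ v) = ∈P.∈-++⁺ʳ (map (false ∷_) (allV n)) (∈P.∈-map⁺ (true ∷_) (∈allV v))

search : {n : ℕ} (p : VSet n) → (∃ λ v → p v ≡ true) ⊎ (∀ v → p v ≡ false)
search {zero} p with p [] in e
... | true = inj₁ ([] , e)
... | false = inj₂ λ { [] → e }
search {suc n} p with search (p ∘ (false ∷_)) | search (p ∘ (true ∷_))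
... | inj₁ (v , e) | _ = inj₁ (false ∷ v , e)
... | inj₂ _ | inj₁ (v , e) = inj₁ (true ∷ v , e)
... | inj₂ none₀ | inj₂ none₁ = inj₂ λ { (false ∷ v) → none₀ v ; (true ∷ v) → none₁ v }

≟V-refl : {n : ℕ} (v : V n) → v ≟V v ≡ true
≟V-refl [] = refl
≟V-refl (false ∷ v) = ≟V-refl v
≟V-refl (true ∷ v) = ≟V-refl v

≟V-sound : {n : ℕ} {u v : V n} → u ≟V v ≡ true → u ≡ v
≟V-sound {u = []} {[]} e = refl
≟V-sound {u = false ∷ u} {false ∷ v} e = cong (false ∷_) (≟V-sound e)
≟V-sound {u = true ∷ u} {true ∷ v} e = cong (true ∷_) (≟V-sound e)

≟V-sym : {n : ℕ} (u v : V n) → u ≟V v ≡ v ≟V u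
≟V-sym [] [] = refl
≟V-sym (false ∷ u) (false ∷ v) = ≟V-sym u v
≟V-sym (false ∷ u) (true ∷ v) = refl
≟V-sym (true ∷ u) (false ∷ v) = refl
≟V-sym (true ∷ u) (true ∷ v) = ≟V-sym u v

∑V-point : {n : ℕ} (v : V n) (c : ℤ) → ∑V (λ u → if u ≟V v then c else +0) ≡ c
∑V-point [] c = ℤP.+-identityʳ c
∑V-point {suc n} (false ∷ v) c =
  trans (∑V-halves {n} (λ u → if u ≟V _ then c else +0))
        (trans (cong₂ _+_ (∑V-point v c) (∑-zero (allV n))) (ℤP.+-identityʳ c))
∑V-point {suc n} (true ∷ v) c =
  trans (∑V-halves {n} (λ u → if u ≟V _ then c else +0))
        (trans (cong₂ _+_ (∑-zero (allV n)) (∑V-point v c)) (ℤP.+-identityˡ c))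

ind : Bool → ℤ
ind true = + 1
ind false = +0

count≡∑ind : {A : Set} (p : A → Bool) (xs : List A) → + count p xs ≡ ∑ xs (λ x → ind (p x))
count≡∑ind p [] = refl
count≡∑ind p (x ∷ xs) with p x
... | true = trans (ℤP.pos-+ 1 (count p xs)) (cong (_+_ (+ 1)) (count≡∑ind p xs))
... | false = trans (count≡∑ind p xs) (sym (ℤP.+-identityˡ _))

sum≡∑ : {A : Set} (g : A → ℕ) (xs : List A) → + sum (map g xs) ≡ ∑ xs (λ x → + g x)
sum≡∑ g [] = refl
sum≡∑ g (x ∷ xs) = trans (ℤP.pos-+ (g x) _) (cong (_+_ (+ g x)) (sum≡∑ g xs))

hamming-sym : {n : ℕ} (u v : V n) → hamming u v ≡ hamming v u
hamming-sym [] [] = refl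
hamming-sym (false ∷ u) (false ∷ v) = hamming-sym u v
hamming-sym (false ∷ u) (true ∷ v) = cong suc (hamming-sym u v)
hamming-sym (true ∷ u) (false ∷ v) = cong suc (hamming-sym u v)
hamming-sym (true ∷ u) (true ∷ v) = hamming-sym u v

adj-sym : {n : ℕ} (u v : V n) → adj u v ≡ adj v u
adj-sym u v = cong (ℕ._≡ᵇ 1) (hamming-sym u v)

hamming-refl : {n : ℕ} (u : V n) → hamming u u ≡ 0
hamming-refl [] = refl
hamming-refl (false ∷ u) = hamming-refl u
hamming-refl (true ∷ u) = hamming-refl u

adj-irrefl : {n : ℕ} (u : V n) → adj u u ≡ false
adj-irrefl u = cong (ℕ._≡ᵇ 1) (hamming-refl u)

adj⇒≢ : {n : ℕ} {u w : V n} → adj u w ≡ true → w ≟V u ≡ false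
adj⇒≢ {u = u} {w} a with w ≟V u in eq
... | false = refl
... | true with ≟V-sound {u = w} eq
... | refl = trans (sym a) (adj-irrefl u)

walk-start : {n : ℕ} {E : VSet n} {a b : V n} → WalkIn E a b → E a ≡ true
walk-start (stop Ea) = Ea
walk-start (step Ea _ _) = Ea

walk-end : {n : ℕ} {E : VSet n} {a b : V n} → WalkIn E a b → E b ≡ true
walk-end (stop Eb) = Eb
walk-end (step _ _ rest) = walk-end rest

walk-++ : {n : ℕ} {E : VSet n} {a b c : V n} → WalkIn E a b → WalkIn E b c → WalkIn E a c
walk-++ (stop _) q = q
walk-++ (step Ea a~x p) q = step Ea a~x (walk-++ p q)

walk-snoc : {n : ℕ} {E : VSet n} {a b c : V n} → WalkIn E a b → adj b c ≡ true → E c ≡ true → WalkIn E a c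
walk-snoc p b~c Ec = walk-++ p (step (walk-end p) b~c (stop Ec))

walk-reverse : {n : ℕ} {E : VSet n} {a b : V n} → WalkIn E a b → WalkIn E b a
walk-reverse (stop Ea) = stop Ea
walk-reverse (step {u = u} {w = w} Eu u~w rest) = walk-snoc (walk-reverse rest) (trans (adj-sym w u) u~w) Eu

connected-closed : {n : ℕ} {E P : VSet n} → InducesConnected E →
  (∀ {u w} → E u ≡ true → E w ≡ true → adj u w ≡ true → P u ≡ true → P w ≡ true) →
  ∀ {v} → E v ≡ true → P v ≡ true → E ⊆ P
connected-closed {E = E} {P} conn closed {v} Ev Pv w Ew = along (conn v w Ev Ew) Pv
  where
  along : ∀ {a b} → WalkIn E a b → P a ≡ true → P b ≡ true
  along (stop _) Pa = Pa
  along (step Ea a~x rest) Pa = along rest (closed Ea (walk-start rest) a~x Pa)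

-- The Laplacian and chip-firing

∑N : {n : ℕ} → V n → (V n → ℤ) → ℤ
∑N w f = ∑V (λ u → if adj w u then f u else +0)

masked-nonneg : {n : ℕ} (w : V n) {f : V n → ℤ} → (∀ u → +0 ≤ℤ f u) → ∀ u → +0 ≤ℤ (if adj w u then f u else +0)
masked-nonneg w f≥0 u with adj w u
... | true = f≥0 u
... | false = ℤP.≤-refl

∑N-nonneg : {n : ℕ} (w : V n) {f : V n → ℤ} → (∀ u → +0 ≤ℤ f u) → +0 ≤ℤ ∑N w f
∑N-nonneg {n} w f≥0 = ∑-nonneg (allV n) (masked-nonneg w f≥0)

term≤∑N : {n : ℕ} (w : V n) {u : V n} {f : V n → ℤ} → (∀ x → +0 ≤ℤ f x) → adj w u ≡ true → f u ≤ℤ ∑N w f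
term≤∑N {n} w {u} {f} f≥0 w~u = subst (_≤ℤ ∑N w f) (cong (λ b → if b then f u else +0) w~u)
  (term≤∑ (allV n) (masked-nonneg w f≥0) (∈allV u))

∑N-cong : {n : ℕ} (w : V n) {f g : V n → ℤ} → (∀ u → f u ≡ g u) → ∑N w f ≡ ∑N w g
∑N-cong {n} w eq = ∑-cong (allV n) λ u → cong (λ z → if adj w u then z else +0) (eq u)

∑N-neg : {n : ℕ} (w : V n) (f : V n → ℤ) → ∑N w (λ u → - f u) ≡ - ∑N w f
∑N-neg {n} w f = trans (∑-cong (allV n) term) (∑-neg (allV n) _)
  where
  term : ∀ u → (if adj w u then - f u else +0) ≡ - (if adj w u then f u else +0)
  term u with adj w u
  ... | true = refl
  ... | false = refl

Δ : {n : ℕ} → (V n → ℤ) → V n → ℤ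
Δ f v = ∑N v (λ u → f v - f u)

Δ-cong : {n : ℕ} {f g : V n → ℤ} → (∀ u → f u ≡ g u) → ∀ v → Δ f v ≡ Δ g v
Δ-cong eq v = ∑N-cong v λ u → cong₂ _-_ (eq v) (eq u)

Δ-+ : {n : ℕ} (f g : V n → ℤ) → ∀ v → Δ (λ x → f x + g x) v ≡ Δ f v + Δ g v
Δ-+ {n} f g v = trans (∑-cong (allV n) λ u → term u (adj v u)) (∑-+ (allV n) _ _)
  where
  distrib : ∀ a b c d → (a + b) - (c + d) ≡ (a - c) + (b - d)
  distrib = solve-∀
  term : ∀ u b → (if b then (f v + g v) - (f u + g u) else +0) ≡
                 (if b then f v - f u else +0) + (if b then g v - g u else +0)
  term u true = distrib (f v) (g v) (f u) (g u)
  term u false = refl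

Δ-const : {n : ℕ} (c : ℤ) (v : V n) → Δ (λ _ → c) v ≡ +0
Δ-const {n} c v = trans (∑-cong (allV n) (λ u → term (adj v u))) (∑-zero (allV n))
  where
  term : ∀ b → (if b then c - c else +0) ≡ +0
  term true = ℤP.+-inverseʳ c
  term false = refl

Δ-neg : {n : ℕ} (f : V n → ℤ) (w : V n) → Δ (λ x → - f x) w ≡ - Δ f w
Δ-neg f w = trans (∑N-cong w λ u → sym (ℤP.neg-distrib-+ (f w) (- f u))) (∑N-neg w _)

δ : {n : ℕ} → V n → V n → ℤ
δ v u = if u ≟V v then + 1 else +0

Δδ-self : {n : ℕ} (v : V n) → Δ (δ v) v ≡ + val v
Δδ-self {n} v = trans (∑-cong (allV n) term) (sym (count≡∑ind (adj v) (allV n)))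
  where
  term : ∀ u → (if adj v u then δ v v - δ v u else +0) ≡ ind (adj v u)
  term u with adj v u in a
  ... | false = refl
  ... | true rewrite ≟V-refl v | adj⇒≢ {u = v} {w = u} a = refl

Δδ-other : {n : ℕ} (v w : V n) → w ≟V v ≡ false → Δ (δ v) w ≡ - ind (adj v w)
Δδ-other {n} v w w≢v = trans (∑-cong (allV n) term) (∑V-point v _)
  where
  term : ∀ u → (if adj w u then δ v w - δ v u else +0) ≡ (if u ≟V v then - ind (adj v w) else +0)
  term u with u ≟V v in e
  ... | true with ≟V-sound {u = u} e
  ... | refl rewrite w≢v | adj-sym w u with adj u w
  ... | true = refl
  ... | false = refl
  term u | false rewrite w≢v with adj w u
  ... | true = refl
  ... | false = refl

Δδ-at : {n : ℕ} (v w : V n) → w ≟V v ≡ true → Δ (δ v) w ≡ + val v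
Δδ-at v w e with ≟V-sound {u = w} e
... | refl = Δδ-self v

fire≡Δδ : {n : ℕ} (v : V n) (D : Divisor n) (w : V n) → fire v D w ≡ D w - Δ (δ v) w
fire≡Δδ v D w with w ≟V v | Δδ-at v w | Δδ-other v w
... | true | Δδ-w | _ = cong (_-_ (D w)) (sym (Δδ-w refl))
... | false | _ | Δδ-w = cong (_+_ (D w)) (trans (indicator (adj v w)) (cong -_ (sym (Δδ-w refl))))
  where
  indicator : ∀ b → (if b then + 1 else +0) ≡ - - ind b
  indicator true = refl
  indicator false = refl

LinearlyEquivalent : {n : ℕ} → Divisor n → Divisor n → Set
LinearlyEquivalent {n} D E = Σ (V n → ℤ) λ f → ∀ w → E w ≡ D w - Δ f w

firing-script : {n : ℕ} {D E : Divisor n} → D ∼ E → LinearlyEquivalent D E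
firing-script {D = D} ε =
  (λ _ → +0) , λ w → sym (trans (cong (_-_ (D w)) (Δ-const +0 w)) (ℤP.+-identityʳ _))
firing-script {D = D} {E} ((v , fired) ◅ rest) with firing-script rest
... | g , eqg = (λ x → δ v x + g x) , λ w → begin
    E w                            ≡⟨ trans (eqg w) (cong (_- Δ g w) (fired w)) ⟩
    fire v D w - Δ g w             ≡⟨ cong (_- Δ g w) (fire≡Δδ v D w) ⟩
    (D w - Δ (δ v) w) - Δ g w      ≡⟨ sub-sub (D w) (Δ (δ v) w) (Δ g w) ⟩
    D w - (Δ (δ v) w + Δ g w)      ≡⟨ cong (_-_ (D w)) (sym (Δ-+ (δ v) g w)) ⟩
    D w - Δ (λ x → δ v x + g x) w  ∎
  where
  open ≡-Reasoning
  sub-sub : ∀ a b c → (a - b) - c ≡ a - (b + c)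
  sub-sub = solve-∀

fireAll : {n : ℕ} → List (V n) → Divisor n → Divisor n
fireAll [] D = D
fireAll (v ∷ vs) D = fireAll vs (fire v D)

fireAll-∼ : {n : ℕ} (vs : List (V n)) (D : Divisor n) → D ∼ fireAll vs D
fireAll-∼ [] D = ε
fireAll-∼ (v ∷ vs) D = (v , λ w → refl) ◅ fireAll-∼ vs (fire v D)

fireAll-Δ : {n : ℕ} (vs : List (V n)) (D : Divisor n) (w : V n) →
            fireAll vs D w ≡ D w - Δ (λ x → ∑ vs (λ v → δ v x)) w
fireAll-Δ [] D w = sym (trans (cong (_-_ (D w)) (Δ-const +0 w)) (ℤP.+-identityʳ (D w)))
fireAll-Δ (v ∷ vs) D w = begin
  fireAll vs (fire v D) w                                    ≡⟨ fireAll-Δ vs (fire v D) w ⟩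
  fire v D w - Δ m w                                         ≡⟨ cong (_- Δ m w) (fire≡Δδ v D w) ⟩
  (D w - Δ (δ v) w) - Δ m w                                  ≡⟨ sub-sub (D w) _ _ ⟩
  D w - (Δ (δ v) w + Δ m w)                                  ≡⟨ cong (_-_ (D w)) (sym (Δ-+ (δ v) m w)) ⟩
  D w - Δ (λ x → δ v x + m x) w                              ∎
  where
  open ≡-Reasoning
  m : V _ → ℤ
  m x = ∑ vs (λ v → δ v x)
  sub-sub : ∀ a b c → (a - b) - c ≡ a - (b + c)
  sub-sub = solve-∀

allBut : {n : ℕ} → V n → List (V n)
allBut {n} q = filterᵇ (λ v → not (v ≟V q)) (allV n)

allBut-multiplicity : {n : ℕ} (q x : V n) → ∑ (allBut q) (λ v → δ v x) ≡ + 1 - δ q x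
allBut-multiplicity {n} q x = begin
  ∑ (allBut q) (λ v → δ v x)                                    ≡⟨ ∑-filterᵇ _ (allV n) _ ⟩
  ∑V (λ v → if not (v ≟V q) then δ v x else +0)                  ≡⟨ ∑-cong (allV n) swap ⟩
  ∑V (λ v → if v ≟V x then (if not (x ≟V q) then + 1 else +0) else +0)  ≡⟨ ∑V-point x _ ⟩
  (if not (x ≟V q) then + 1 else +0)                             ≡⟨ complement (x ≟V q) ⟩
  + 1 - δ q x                                                    ∎
  where
  open ≡-Reasoning
  swap : ∀ v → (if not (v ≟V q) then δ v x else +0) ≡ (if v ≟V x then (if not (x ≟V q) then + 1 else +0) else +0)
  swap v rewrite ≟V-sym x v with v ≟V x in e
  ... | false with v ≟V q
  ...   | true = refl
  ...   | false = refl
  swap v | true rewrite ≟V-sound {u = v} e = refl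
  complement : ∀ b → (if not b then + 1 else +0) ≡ + 1 - (if b then + 1 else +0)
  complement true = refl
  complement false = refl

-- Firing every vertex changes nothing, so firing every vertex but q is firing q backwards.
fireAll-allBut : {n : ℕ} (q : V n) (D : Divisor n) (w : V n) → fireAll (allBut q) D w ≡ D w + Δ (δ q) w
fireAll-allBut q D w = begin
  fireAll (allBut q) D w                           ≡⟨ fireAll-Δ (allBut q) D w ⟩
  D w - Δ (λ x → ∑ (allBut q) (λ v → δ v x)) w     ≡⟨ cong (_-_ (D w)) (Δ-cong (allBut-multiplicity q) w) ⟩
  D w - Δ (λ x → + 1 - δ q x) w                    ≡⟨ cong (_-_ (D w)) (Δ-+ (λ _ → + 1) (λ x → - δ q x) w) ⟩
  D w - (Δ (λ _ → + 1) w + Δ (λ x → - δ q x) w)    ≡⟨ cong₂ (λ a b → D w - (a + b)) (Δ-const (+ 1) w) (Δ-neg (δ q) w) ⟩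
  D w - (+0 + - Δ (δ q) w)                         ≡⟨ cancel (D w) (Δ (δ q) w) ⟩
  D w + Δ (δ q) w                                  ∎
  where
  open ≡-Reasoning
  cancel : ∀ a b → a - (+0 + - b) ≡ a + b
  cancel = solve-∀

∑Δ≡0 : {n : ℕ} (f : V n → ℤ) → ∑V (Δ f) ≡ +0
∑Δ≡0 {n} f = begin
    ∑V (Δ f)
  ≡⟨ ∑-cong (allV n) (λ v → trans (∑-cong (allV n) (split v)) (∑-+ (allV n) _ _)) ⟩
    ∑V (λ v → ∑V (a v) + ∑V (λ u → - a u v))
  ≡⟨ ∑-+ (allV n) _ _ ⟩
    ∑V (λ v → ∑V (a v)) + ∑V (λ v → ∑V (λ u → - a u v))
  ≡⟨ cong (_+_ (∑V (λ v → ∑V (a v)))) (∑-swap (allV n) (allV n) (λ v u → - a u v)) ⟩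
    ∑V (λ v → ∑V (a v)) + ∑V (λ u → ∑V (λ v → - a u v))
  ≡⟨ cong (_+_ (∑V (λ v → ∑V (a v)))) (trans (∑-cong (allV n) (λ u → ∑-neg (allV n) (a u))) (∑-neg (allV n) _)) ⟩
    ∑V (λ v → ∑V (a v)) - ∑V (λ u → ∑V (a u))
  ≡⟨ ℤP.+-inverseʳ (∑V (λ v → ∑V (a v))) ⟩
    +0 ∎
  where
  open ≡-Reasoning
  a : V n → V n → ℤ
  a v u = if adj v u then f v else +0
  split : ∀ v u → (if adj v u then f v - f u else +0) ≡ a v u + - a u v
  split v u rewrite adj-sym u v with adj v u
  ... | true = refl
  ... | false = refl

deg-Δ : {n : ℕ} (X : Divisor n) (f : V n → ℤ) → deg (λ w → X w - Δ f w) ≡ deg X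
deg-Δ {n} X f = trans (∑-+ (allV n) X (λ w → - Δ f w))
  (trans (cong (_+_ (deg X)) (trans (∑-neg (allV n) (Δ f)) (cong -_ (∑Δ≡0 f)))) (ℤP.+-identityʳ _))

deg-cong : {n : ℕ} {X Y : Divisor n} → (∀ w → X w ≡ Y w) → deg X ≡ deg Y
deg-cong {n} = ∑-cong (allV n)

linEq-deg : {n : ℕ} {D X : Divisor n} → LinearlyEquivalent D X → deg X ≡ deg D
linEq-deg {D = D} (f , X≡) = trans (deg-cong X≡) (deg-Δ D f)

linEq-lower : {n : ℕ} {D X : Divisor n} → LinearlyEquivalent D X → (g : V n → ℤ) →
              LinearlyEquivalent D (λ w → X w - Δ g w)
linEq-lower {D = D} {X} (f , X≡) g = (λ v → f v + g v) , λ w →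
  trans (cong (_- Δ g w) (X≡ w)) (trans (sub-sub (D w) (Δ f w) (Δ g w)) (cong (_-_ (D w)) (sym (Δ-+ f g w))))
  where
  sub-sub : ∀ a b c → (a - b) - c ≡ a - (b + c)
  sub-sub = solve-∀

linEq-difference : {n : ℕ} {D X Y : Divisor n} ((f , _) : LinearlyEquivalent D X) ((g , _) : LinearlyEquivalent D Y) →
                   ∀ w → Y w ≡ X w - Δ (λ v → g v - f v) w
linEq-difference {D = D} {X} {Y} (f , X≡) (g , Y≡) w = begin
  Y w                                 ≡⟨ Y≡ w ⟩
  D w - Δ g w                         ≡⟨ cong (_-_ (D w)) (Δ-cong (λ v → split (g v) (f v)) w) ⟩
  D w - Δ (λ v → f v + (g v - f v)) w ≡⟨ cong (_-_ (D w)) (Δ-+ f _ w) ⟩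
  D w - (Δ f w + Δ (λ v → g v - f v) w) ≡⟨ sym (sub-sub (D w) (Δ f w) _) ⟩
  (D w - Δ f w) - Δ (λ v → g v - f v) w ≡⟨ cong (_- Δ (λ v → g v - f v) w) (sym (X≡ w)) ⟩
  X w - Δ (λ v → g v - f v) w         ∎
  where
  open ≡-Reasoning
  split : ∀ a b → a ≡ b + (a - b)
  split = solve-∀
  sub-sub : ∀ a b c → (a - b) - c ≡ a - (b + c)
  sub-sub = solve-∀

positive-rank-targets : {n : ℕ} {D : Divisor n} → PositiveRank D → ∀ q →
  ∃ λ Y → LinearlyEquivalent D Y × Effective Y × + 1 ≤ℤ Y q
positive-rank-targets {D = D} pr q with pr q
... | E , E≥0 , D-q∼E with firing-script D-q∼E
... | f , E≡ = (λ w → E w + δ q w) , (f , Y≡) , (λ w → ℤP.+-mono-≤ (E≥0 w) (δ≥0 w)) ,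
               ℤP.≤-trans (ℤP.+-mono-≤ (E≥0 q) (ℤP.≤-reflexive (sym (δ-self q)))) ℤP.≤-refl
  where
  δ≥0 : ∀ w → +0 ≤ℤ δ q w
  δ≥0 w with w ≟V q
  ... | true = ℤ.+≤+ z≤n
  ... | false = ℤP.≤-refl
  δ-self : ∀ q → δ q q ≡ + 1
  δ-self q rewrite ≟V-refl q = refl
  restore : ∀ w → minusChip D q w + δ q w ≡ D w
  restore w with w ≟V q
  ... | true = cancel (D w)
    where
    cancel : ∀ a → (a - + 1) + + 1 ≡ a
    cancel = solve-∀
  ... | false = ℤP.+-identityʳ (D w)
  Y≡ : ∀ w → E w + δ q w ≡ D w - Δ f w
  Y≡ w = trans (cong (_+ δ q w) (E≡ w)) (trans (swap (minusChip D q w) (Δ f w) (δ q w)) (cong (_- Δ f w) (restore w)))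
    where
    swap : ∀ a b c → (a - b) + c ≡ (a + c) - b
    swap = solve-∀

1≤sub : ∀ {a b} → b <ℤ a → + 1 ≤ℤ a - b
1≤sub {a} {b} b<a = ℤP.≤-trans (ℤP.≤-reflexive (sym (cancel b))) (ℤP.+-monoˡ-≤ (- b) (ℤP.i<j⇒suc[i]≤j b<a))
  where
  cancel : ∀ b → (+ 1 + b) - b ≡ + 1
  cancel = solve-∀

¬1≤0 : ∀ {x} → + 1 ≤ℤ x → x ≡ +0 → ⊥
¬1≤0 (ℤ.+≤+ ()) refl

squeeze-0 : ∀ {a b} → +0 ≤ℤ a → a ≤ℤ b → b ≡ +0 → a ≡ +0
squeeze-0 0≤a a≤b refl = ℤP.≤-antisym a≤b 0≤a

-- The scramble number is at most the gonality

module _ {n : ℕ} (t : ℤ) (h : V n → ℤ) where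

  clip : V n → ℤ
  clip v = h v ⊓ t

  excess : V n → ℤ
  excess v = h v - clip v

  Above : VSet n
  Above v = does (t ℤP.<? h v)

  Below : VSet n
  Below v = does (h v ℤP.<? t)

  clip≤level : ∀ v → clip v ≤ℤ t
  clip≤level v = ℤP.i⊓j≤j (h v) t

  clip-below : ∀ {v} → h v ≤ℤ t → clip v ≡ h v
  clip-below = ℤP.i≤j⇒i⊓j≡i

  clip-above : ∀ {v} → t ≤ℤ h v → clip v ≡ t
  clip-above = ℤP.i≥j⇒i⊓j≡j

  excess-nonneg : ∀ v → +0 ≤ℤ excess v
  excess-nonneg v = ℤP.i≤j⇒0≤j-i (ℤP.i⊓j≤i (h v) t)

  excess-below : ∀ {v} → h v ≤ℤ t → excess v ≡ +0
  excess-below {v} hv≤t = trans (cong (_-_ (h v)) (clip-below hv≤t)) (ℤP.+-inverseʳ (h v))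

  excess-above : ∀ {v} → t <ℤ h v → + 1 ≤ℤ excess v
  excess-above {v} t<hv = subst (λ c → + 1 ≤ℤ h v - c) (sym (clip-above (ℤP.<⇒≤ t<hv))) (1≤sub t<hv)

excess-step : {n : ℕ} (t : ℤ) (h : V n → ℤ) (v : V n) →
              excess t h v ≡ excess (ℤ.suc t) h v + ind (Above t h v)
excess-step t h v with t ℤP.<? h v
... | yes t<hv = begin
  h v - clip t h v              ≡⟨ cong (_-_ (h v)) (clip-above t h (ℤP.<⇒≤ t<hv)) ⟩
  h v - t                       ≡⟨ shift (h v) t ⟩
  (h v - ℤ.suc t) + + 1         ≡⟨ cong (λ c → (h v - c) + + 1) (sym (clip-above (ℤ.suc t) h (ℤP.i<j⇒suc[i]≤j t<hv))) ⟩
  excess (ℤ.suc t) h v + + 1    ∎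
  where
  open ≡-Reasoning
  shift : ∀ a t → a - t ≡ (a - (+ 1 + t)) + + 1
  shift = solve-∀
... | no t≮hv = begin
  h v - clip t h v              ≡⟨ cong (_-_ (h v)) (clip-below t h hv≤t) ⟩
  h v - h v                     ≡⟨ sym (cong (_-_ (h v)) (clip-below (ℤ.suc t) h (ℤP.≤-trans hv≤t (ℤP.i≤suc[i] t)))) ⟩
  excess (ℤ.suc t) h v          ≡⟨ sym (ℤP.+-identityʳ _) ⟩
  excess (ℤ.suc t) h v + +0     ∎
  where
  open ≡-Reasoning
  hv≤t : h v ≤ℤ t
  hv≤t = ℤP.≮⇒≥ t≮hv

module _ {n : ℕ} (X : Divisor n) (t : ℤ) (h : V n → ℤ) where

  lowered-below : ∀ {w} → h w ≤ℤ t → X w - Δ (excess t h) w ≡ X w + ∑N w (excess t h)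
  lowered-below {w} hw≤t = begin
    X w - Δ (excess t h) w                     ≡⟨ cong (_-_ (X w)) Δ-excess ⟩
    X w - - ∑N w (excess t h)                  ≡⟨ cong (_+_ (X w)) (ℤP.neg-involutive _) ⟩
    X w + ∑N w (excess t h)                    ∎
    where
    open ≡-Reasoning
    Δ-excess : Δ (excess t h) w ≡ - ∑N w (excess t h)
    Δ-excess = trans (∑N-cong w λ u → trans (cong (_- excess t h u) (excess-below t h hw≤t)) (ℤP.+-identityˡ _))
                     (∑N-neg w (excess t h))

  lowered-above : ∀ {w} → t ≤ℤ h w →
                  X w - Δ (excess t h) w ≡ (X w - Δ h w) + ∑N w (λ u → t - clip t h u)
  lowered-above {w} t≤hw = begin
    X w - Δ (excess t h) w                                 ≡⟨ regroup (X w) (Δ (excess t h) w) (Δ (clip t h) w) ⟩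
    (X w - (Δ (excess t h) w + Δ (clip t h) w)) + Δ (clip t h) w
                                                           ≡⟨ cong₂ (λ a b → (X w - a) + b) (sym Δh) Δ-clip ⟩
    (X w - Δ h w) + ∑N w (λ u → t - clip t h u)            ∎
    where
    open ≡-Reasoning
    regroup : ∀ x a c → x - a ≡ (x - (a + c)) + c
    regroup = solve-∀
    split : ∀ a c → a ≡ (a - c) + c
    split = solve-∀
    Δh : Δ h w ≡ Δ (excess t h) w + Δ (clip t h) w
    Δh = trans (Δ-cong (λ u → split (h u) (clip t h u)) w) (Δ-+ (excess t h) (clip t h) w)
    Δ-clip : Δ (clip t h) w ≡ ∑N w (λ u → t - clip t h u)
    Δ-clip = ∑N-cong w λ u → cong (_- clip t h u) (clip-above t h t≤hw)

  lowered-effective : Effective X → Effective (λ w → X w - Δ h w) →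
                      Effective (λ w → X w - Δ (excess t h) w)
  lowered-effective X≥0 Y≥0 w with ℤP.≤-total (h w) t
  ... | inj₁ hw≤t = subst (+0 ≤ℤ_) (sym (lowered-below hw≤t))
                      (ℤP.+-mono-≤ (X≥0 w) (∑N-nonneg w (excess-nonneg t h)))
  ... | inj₂ t≤hw = subst (+0 ≤ℤ_) (sym (lowered-above t≤hw))
                      (ℤP.+-mono-≤ (Y≥0 w) (∑N-nonneg w λ u → ℤP.i≤j⇒0≤j-i (clip≤level t h u)))

Chipless : {n : ℕ} → Divisor n → VSet n → Set
Chipless Z E = ∀ v → E v ≡ true → Z v ≡ +0

HasEggIn : {n : ℕ} → Scramble n → VSet n → Set
HasEggIn S U = ∃ λ E → Egg S E × E ⊆ U

¬HasEggIn-empty : {n : ℕ} (S : Scramble n) {U : VSet n} → (∀ v → U v ≡ false) → ¬ HasEggIn S U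
¬HasEggIn-empty S U-empty (E , egg , E⊆U) with eggNonempty S E egg
... | v , Ev with trans (sym (E⊆U v Ev)) (U-empty v)
... | ()

a≤a+∑N : {n : ℕ} (a : ℤ) (w : V n) {f : V n → ℤ} → (∀ u → +0 ≤ℤ f u) → a ≤ℤ a + ∑N w f
a≤a+∑N a w f≥0 = ℤP.i≤i+j a _ {{ℤ.nonNegative (∑N-nonneg w f≥0)}}

1≤a+∑N : {n : ℕ} {a : ℤ} (w : V n) {u : V n} {f : V n → ℤ} → +0 ≤ℤ a → (∀ x → +0 ≤ℤ f x) →
         adj w u ≡ true → + 1 ≤ℤ f u → + 1 ≤ℤ a + ∑N w f
1≤a+∑N {a = a} w 0≤a f≥0 w~u 1≤fu =
  ℤP.i≤j⇒i≤k+j a {{ℤ.nonNegative 0≤a}} (ℤP.≤-trans 1≤fu (term≤∑N w f≥0 w~u))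

-- After lowering, a vertex at most at the level with a neighbour above it, and a vertex at least at
-- the level with a neighbour below it, carry a chip. So a chipless egg does not cross the level; as no
-- egg lies strictly above or below it, the egg sits at the level, where the lowered divisor
-- dominates both X and X - Δ h.
module _ {n : ℕ} (S : Scramble n) (X : Divisor n) (t : ℤ) (h : V n → ℤ)
         (X≥0 : Effective X) (Y≥0 : Effective (λ w → X w - Δ h w))
         (none-above : ¬ HasEggIn S (Above t h)) (none-below : ¬ HasEggIn S (Below t h))
         (E : VSet n) (egg : Egg S E) (no-chips : Chipless (λ w → X w - Δ (excess t h) w) E) where

  private
    up-closed : ∀ {u w} → E u ≡ true → E w ≡ true → adj u w ≡ true → Above t h u ≡ true → Above t h w ≡ true
    up-closed {u} {w} Eu Ew u~w u-above with t ℤP.<? h w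
    ... | yes _ = refl
    ... | no t≮hw = ⊥-elim (¬1≤0 chip (no-chips w Ew))
      where
      chip : + 1 ≤ℤ X w - Δ (excess t h) w
      chip = subst (+ 1 ≤ℤ_) (sym (lowered-below X t h (ℤP.≮⇒≥ t≮hw)))
        (1≤a+∑N w (X≥0 w) (excess-nonneg t h) (trans (adj-sym w u) u~w) (excess-above t h (does⇒ (t ℤP.<? h u) u-above)))

    down-closed : ∀ {u w} → E u ≡ true → E w ≡ true → adj u w ≡ true → Below t h u ≡ true → Below t h w ≡ true
    down-closed {u} {w} Eu Ew u~w u-below with h w ℤP.<? t
    ... | yes _ = refl
    ... | no hw≮t = ⊥-elim (¬1≤0 chip (no-chips w Ew))
      where
      hu<t : h u <ℤ t
      hu<t = does⇒ (h u ℤP.<? t) u-below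
      gap : + 1 ≤ℤ t - clip t h u
      gap = subst (λ c → + 1 ≤ℤ t - c) (sym (clip-below t h (ℤP.<⇒≤ hu<t))) (1≤sub hu<t)
      chip : + 1 ≤ℤ X w - Δ (excess t h) w
      chip = subst (+ 1 ≤ℤ_) (sym (lowered-above X t h (ℤP.≮⇒≥ hw≮t)))
        (1≤a+∑N w (Y≥0 w) (λ x → ℤP.i≤j⇒0≤j-i (clip≤level t h x)) (trans (adj-sym w u) u~w) gap)

    at-most-level : ∀ {v} → E v ≡ true → h v ≤ℤ t
    at-most-level {v} Ev with t ℤP.<? h v in above
    ... | no t≮hv = ℤP.≮⇒≥ t≮hv
    ... | yes _ = ⊥-elim (none-above (E , egg , connected-closed (eggConnected S E egg) up-closed Ev (cong does above)))

    at-least-level : ∀ {v} → E v ≡ true → t ≤ℤ h v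
    at-least-level {v} Ev with h v ℤP.<? t in below
    ... | no hv≮t = ℤP.≮⇒≥ hv≮t
    ... | yes _ = ⊥-elim (none-below (E , egg , connected-closed (eggConnected S E egg) down-closed Ev (cong does below)))

  chipless-before : Chipless X E
  chipless-before v Ev = squeeze-0 (X≥0 v)
    (subst (X v ≤ℤ_) (sym (lowered-below X t h (at-most-level Ev))) (a≤a+∑N (X v) v (excess-nonneg t h)))
    (no-chips v Ev)

  chipless-target : Chipless (λ w → X w - Δ h w) E
  chipless-target v Ev = squeeze-0 (Y≥0 v)
    (subst (X v - Δ h v ≤ℤ_) (sym (lowered-above X t h (at-least-level Ev)))
      (a≤a+∑N (X v - Δ h v) v λ x → ℤP.i≤j⇒0≤j-i (clip≤level t h x)))
    (no-chips v Ev)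

cutSize≡∑ : {n : ℕ} (A : VSet n) → + cutSize A ≡ ∑V (λ u → ∑V (λ w → ind (A u ∧ not (A w) ∧ adj u w)))
cutSize≡∑ {n} A = trans (sum≡∑ _ (allV n)) (∑-cong (allV n) (λ u → count≡∑ind _ (allV n)))

-- Firing the set U takes one chip across each edge leaving U.
cutSize≤deg : {n : ℕ} (U : VSet n) (Z : Divisor n) → Effective Z →
              Effective (λ u → Z u - Δ (ind ∘ U) u) → + cutSize U ≤ℤ deg Z
cutSize≤deg {n} U Z Z≥0 Z′≥0 = begin
  + cutSize U                                             ≡⟨ cutSize≡∑ U ⟩
  ∑V (λ u → ∑V (λ w → ind (U u ∧ not (U w) ∧ adj u w)))   ≤⟨ ∑-mono (allV n) leaving≤ ⟩
  deg Z                                                   ∎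
  where
  open ℤP.≤-Reasoning
  leaving≤ : ∀ u → ∑V (λ w → ind (U u ∧ not (U w) ∧ adj u w)) ≤ℤ Z u
  leaving≤ u with U u in Uu
  ... | false = ℤP.≤-trans (ℤP.≤-reflexive (∑-zero (allV n))) (Z≥0 u)
  ... | true = ℤP.≤-trans (ℤP.≤-reflexive (∑-cong (allV n) term)) (ℤP.0≤i-j⇒j≤i (Z′≥0 u))
    where
    term : ∀ w → ind (not (U w) ∧ adj u w) ≡ (if adj u w then ind (U u) - ind (U w) else +0)
    term w rewrite Uu with U w | adj u w
    ... | true | true = refl
    ... | true | false = refl
    ... | false | true = refl
    ... | false | false = refl

bounds : {n : ℕ} (h : V n → ℤ) → ∃₂ λ lo hi → lo ≤ℤ hi × (∀ v → lo ≤ℤ h v × h v ≤ℤ hi)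
bounds {zero} h = h [] , h [] , ℤP.≤-refl , λ { [] → ℤP.≤-refl , ℤP.≤-refl }
bounds {suc n} h with bounds (h ∘ (false ∷_)) | bounds (h ∘ (true ∷_))
... | lo₀ , hi₀ , lo₀≤hi₀ , within₀ | lo₁ , hi₁ , _ , within₁ =
  lo₀ ⊓ lo₁ , hi₀ ⊔ hi₁ , ℤP.≤-trans (ℤP.i⊓j≤i lo₀ lo₁) (ℤP.≤-trans lo₀≤hi₀ (ℤP.i≤i⊔j hi₀ hi₁)) , within
  where
  within : ∀ v → lo₀ ⊓ lo₁ ≤ℤ h v × h v ≤ℤ hi₀ ⊔ hi₁
  within (false ∷ v) = ℤP.≤-trans (ℤP.i⊓j≤i lo₀ lo₁) (proj₁ (within₀ v))
                     , ℤP.≤-trans (proj₂ (within₀ v)) (ℤP.i≤i⊔j hi₀ hi₁)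
  within (true ∷ v) = ℤP.≤-trans (ℤP.i⊓j≤j lo₀ lo₁) (proj₁ (within₁ v))
                    , ℤP.≤-trans (proj₂ (within₁ v)) (ℤP.i≤j⊔i hi₀ hi₁)

-- When every egg-cut is larger than the degree of X, some level has no egg strictly above or
-- strictly below it: otherwise the set above some level j would be an egg-cut, and it can be
-- fired from X - Δ (excess (j + 1) h) to X - Δ (excess j h), both effective.
module _ {n : ℕ} (S : Scramble n) {k : ℕ} (large-cuts : ∀ A → EggCut S A → k ≤ cutSize A)
         (X : Divisor n) (h : V n → ℤ) (X≥0 : Effective X) (Y≥0 : Effective (λ w → X w - Δ h w))
         (deg<k : deg X <ℤ + k) where

  private
    lowered-effective′ : ∀ t → Effective (λ w → X w - Δ (excess t h) w)
    lowered-effective′ t = lowered-effective X t h X≥0 Y≥0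

    NoneAbove : ℤ → Set
    NoneAbove t = ¬ HasEggIn S (Above t h)

  no-egg-cut-at : ∀ j → HasEggIn S (Above j h) → ¬ HasEggIn S (Below (ℤ.suc j) h)
  no-egg-cut-at j (E₁ , egg₁ , E₁-above) (E₂ , egg₂ , E₂-below) =
    ℤP.<-irrefl refl (ℤP.≤-<-trans (ℤP.≤-trans cut≥k cut≤deg) deg<k)
    where
    U : VSet n
    U = Above j h
    below⊆compl : ∀ v → Below (ℤ.suc j) h v ≡ true → compl U v ≡ true
    below⊆compl v below = cong not (dec-false (j ℤP.<? h v)
      λ j<hv → ℤP.<-irrefl refl (ℤP.<-≤-trans (does⇒ (h v ℤP.<? ℤ.suc j) below) (ℤP.i<j⇒suc[i]≤j j<hv)))
    cut≥k : + k ≤ℤ + cutSize U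
    cut≥k = ℤ.+≤+ (large-cuts U ((E₁ , egg₁ , E₁-above) , (E₂ , egg₂ , λ v Ev → below⊆compl v (E₂-below v Ev))))
    fired : ∀ w → (X w - Δ (excess (ℤ.suc j) h) w) - Δ (ind ∘ U) w ≡ X w - Δ (excess j h) w
    fired w = trans (sub-sub (X w) _ _)
      (cong (_-_ (X w)) (sym (trans (Δ-cong (excess-step j h) w) (Δ-+ (excess (ℤ.suc j) h) (ind ∘ U) w))))
      where
      sub-sub : ∀ a b c → (a - b) - c ≡ a - (b + c)
      sub-sub = solve-∀
    cut≤deg : + cutSize U ≤ℤ deg X
    cut≤deg = ℤP.≤-trans
      (cutSize≤deg U _ (lowered-effective′ (ℤ.suc j)) (λ w → subst (+0 ≤ℤ_) (sym (fired w)) (lowered-effective′ j w)))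
      (ℤP.≤-reflexive (deg-Δ X (excess (ℤ.suc j) h)))

  level-free-of-eggs : ¬ ¬ ∃ λ t → ¬ HasEggIn S (Above t h) × ¬ HasEggIn S (Below t h)
  level-free-of-eggs with bounds h
  ... | lo , hi , lo≤hi , within = scan ℤ.∣ hi - lo ∣ lo nothing-below (subst NoneAbove (sym reach) nothing-above)
    where
    scan : ∀ d t → ¬ HasEggIn S (Below t h) → NoneAbove (t + + d) →
           ¬ ¬ ∃ λ t → ¬ HasEggIn S (Above t h) × ¬ HasEggIn S (Below t h)
    scan zero t none-below none-above found =
      found (t , subst NoneAbove (ℤP.+-identityʳ t) none-above , none-below)
    scan (suc d) t none-below none-above found = ¬¬-excluded-middle λ
      { (yes egg-above) → scan d (ℤ.suc t) (no-egg-cut-at t egg-above)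
                            (subst NoneAbove (reindex t d) none-above) found
      ; (no none-above′) → found (t , none-above′ , none-below) }
      where
      reindex : ∀ t d → t + + suc d ≡ ℤ.suc t + + d
      reindex t d = trans (cong (_+_ t) (ℤP.pos-+ 1 d)) (shuffle t (+ d))
        where
        shuffle : ∀ t e → t + (+ 1 + e) ≡ (+ 1 + t) + e
        shuffle = solve-∀
    reach : lo + + ℤ.∣ hi - lo ∣ ≡ hi
    reach = trans (cong (_+_ lo) (ℤP.0≤i⇒+∣i∣≡i (ℤP.i≤j⇒0≤j-i lo≤hi))) (cancel lo hi)
      where
      cancel : ∀ a b → a + (b - a) ≡ b
      cancel = solve-∀
    nothing-below : ¬ HasEggIn S (Below lo h)
    nothing-below = ¬HasEggIn-empty S λ v → dec-false (h v ℤP.<? lo) (ℤP.≤⇒≯ (proj₁ (within v)))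
    nothing-above : ¬ HasEggIn S (Above hi h)
    nothing-above = ¬HasEggIn-empty S λ v → dec-false (hi ℤP.<? h v) (ℤP.≤⇒≯ (proj₂ (within v)))

support : {n : ℕ} → Divisor n → VSet n
support X v = does (+0 ℤP.<? X v)

size-support≤deg : {n : ℕ} (X : Divisor n) → Effective X → + size (support X) ≤ℤ deg X
size-support≤deg {n} X X≥0 =
  ℤP.≤-trans (ℤP.≤-reflexive (count≡∑ind (support X) (allV n))) (∑-mono (allV n) ind≤)
  where
  ind≤ : ∀ v → ind (support X v) ≤ℤ X v
  ind≤ v with +0 ℤP.<? X v
  ... | yes 0<Xv = ℤP.i<j⇒suc[i]≤j 0<Xv
  ... | no _ = X≥0 v

module _ {n : ℕ} (S : Scramble n) {k : ℕ} (order≥k : OrderAtLeast S k)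
         (D : Divisor n) (deg<k : deg D <ℤ + k) where

  private
    large-cuts : ∀ A → EggCut S A → k ≤ cutSize A
    large-cuts = proj₂ order≥k

  refine : (X Y : Divisor n) → LinearlyEquivalent D X → LinearlyEquivalent D Y → Effective X → Effective Y →
    ¬ ¬ ∃ λ X′ → LinearlyEquivalent D X′ × Effective X′ ×
                 (∀ E → Egg S E → Chipless X′ E → Chipless X E × Chipless Y E)
  refine X Y X~D Y~D X≥0 Y≥0 found =
    level-free-of-eggs S large-cuts X h X≥0 Y′≥0 (subst (_<ℤ + k) (sym (linEq-deg {D = D} X~D)) deg<k)
      λ (t , none-above , none-below) →
        found ( (λ w → X w - Δ (excess t h) w) , linEq-lower {D = D} X~D (excess t h)
              , lowered-effective X t h X≥0 Y′≥0
              , λ E egg no-chips → chipless-before S X t h X≥0 Y′≥0 none-above none-below E egg no-chips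
                                 , λ v Ev → trans (Y≡ v) (chipless-target S X t h X≥0 Y′≥0 none-above none-below E egg no-chips v Ev))
    where
    h : V n → ℤ
    h v = proj₁ Y~D v - proj₁ X~D v
    Y≡ : ∀ w → Y w ≡ X w - Δ h w
    Y≡ = linEq-difference {D = D} X~D Y~D
    Y′≥0 : Effective (λ w → X w - Δ h w)
    Y′≥0 w = subst (+0 ≤ℤ_) (Y≡ w) (Y≥0 w)

  module _ (targets : ∀ q → ∃ λ Y → LinearlyEquivalent D Y × Effective Y × + 1 ≤ℤ Y q) where

    private
      Y : V n → Divisor n
      Y q = proj₁ (targets q)
      Y~D : ∀ q → LinearlyEquivalent D (Y q)
      Y~D q = proj₁ (proj₂ (targets q))
      Y≥0 : ∀ q → Effective (Y q)
      Y≥0 q = proj₁ (proj₂ (proj₂ (targets q)))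
      Y-chip : ∀ q → + 1 ≤ℤ Y q q
      Y-chip q = proj₂ (proj₂ (proj₂ (targets q)))

    common-refinement : (qs : List (V n)) →
      ¬ ¬ ∃ λ X → LinearlyEquivalent D X × Effective X ×
                  (∀ E → Egg S E → Chipless X E → ∀ q → q ∈ qs → Chipless (Y q) E)
    common-refinement [] found = found (Y q₀ , Y~D q₀ , Y≥0 q₀ , λ _ _ _ _ ())
      where
      q₀ : V n
      q₀ = replicate n false
    common-refinement (q ∷ qs) found =
      common-refinement qs λ (X , X~D , X≥0 , X-good) →
        refine X (Y q) X~D (Y~D q) X≥0 (Y≥0 q) λ (X′ , X′~D , X′≥0 , keeps) →
          found (X′ , X′~D , X′≥0 , λ
            { E egg no-chips q (here refl) → proj₂ (keeps E egg no-chips)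
            ; E egg no-chips q′ (there q′∈qs) → X-good E egg (proj₁ (keeps E egg no-chips)) q′ q′∈qs })

    small-degree-absurd : ⊥
    small-degree-absurd = common-refinement (allV n) λ (X , X~D , X≥0 , X-good) →
      ℤP.<-irrefl refl (ℤP.≤-<-trans (ℤ.+≤+ (proj₁ order≥k (support X) (support-hits X X≥0 X-good)))
        (ℤP.≤-<-trans (size-support≤deg X X≥0) (subst (_<ℤ + k) (sym (linEq-deg {D = D} X~D)) deg<k)))
      where
      support-hits : ∀ X → Effective X → (∀ E → Egg S E → Chipless X E → ∀ q → q ∈ allV n → Chipless (Y q) E) →
                     Hits S (support X)
      support-hits X X≥0 X-good E egg with search (λ v → support X v ∧ E v)
      ... | inj₁ (v , e) = v , ∧-true e
      ... | inj₂ none with eggNonempty S E egg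
      ... | q , Eq = ⊥-elim (¬1≤0 (Y-chip q) (X-good E egg chipless q (∈allV q) q Eq))
        where
        outside-support : ∀ v → support X v ≡ false → X v ≡ +0
        outside-support v e with +0 ℤP.<? X v
        ... | no 0≮Xv = ℤP.≤-antisym (ℤP.≮⇒≥ 0≮Xv) (X≥0 v)
        chipless : Chipless X E
        chipless v Ev = outside-support v (trans (sym (BoolP.∧-identityʳ _)) (subst (λ b → support X v ∧ b ≡ false) Ev (none v)))

gonality≥order : {n : ℕ} (S : Scramble n) {k : ℕ} → OrderAtLeast S k →
                 (D : Divisor n) → PositiveRank D → + k ≤ℤ deg D
gonality≥order S {k} order≥k D pr with + k ℤP.≤? deg D
... | yes k≤deg = k≤deg
... | no k≰deg = ⊥-elim (small-degree-absurd S order≥k D (ℤP.≰⇒> k≰deg) (positive-rank-targets pr))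

module _ {A : Set} where

  count-cong : {p q : A → Bool} (xs : List A) → (∀ x → p x ≡ q x) → count p xs ≡ count q xs
  count-cong [] eq = refl
  count-cong (x ∷ xs) eq rewrite eq x | count-cong xs eq = refl

  count-++ : (p : A → Bool) (xs ys : List A) → count p (xs ++ ys) ≡ count p xs ℕ.+ count p ys
  count-++ p [] ys = refl
  count-++ p (x ∷ xs) ys = trans (cong ((if p x then 1 else 0) ℕ.+_) (count-++ p xs ys))
                                 (sym (ℕP.+-assoc (if p x then 1 else 0) _ _))

  count-mono : {p q : A → Bool} (xs : List A) → (∀ x → p x ≡ true → q x ≡ true) → count p xs ≤ count q xs
  count-mono [] p⇒q = z≤n
  count-mono {p} {q} (x ∷ xs) p⇒q with p x in px | q x in qx
  ... | true | true = s≤s (count-mono xs p⇒q)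
  ... | true | false with () ← trans (sym (p⇒q x px)) qx
  ... | false | true = ℕP.m≤n⇒m≤1+n (count-mono xs p⇒q)
  ... | false | false = count-mono xs p⇒q

  count+count-not : (p : A → Bool) (xs : List A) → count p xs ℕ.+ count (not ∘ p) xs ≡ length xs
  count+count-not p [] = refl
  count+count-not p (x ∷ xs) with p x
  ... | true = cong suc (count+count-not p xs)
  ... | false = trans (ℕP.+-suc (count p xs) _) (cong suc (count+count-not p xs))

  count-split : (p q : A → Bool) (xs : List A) →
                count p xs ≡ count (λ x → p x ∧ q x) xs ℕ.+ count (λ x → p x ∧ not (q x)) xs
  count-split p q [] = refl
  count-split p q (x ∷ xs) with p x | q x
  ... | true | true = cong suc (count-split p q xs)
  ... | true | false = trans (cong suc (count-split p q xs)) (sym (ℕP.+-suc _ _))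
  ... | false | _ = count-split p q xs

  count-pos : (p : A → Bool) {xs : List A} {x : A} → x ∈ xs → p x ≡ true → 1 ≤ count p xs
  count-pos p (here refl) px rewrite px = s≤s z≤n
  count-pos p {y ∷ _} (there x∈xs) px with p y
  ... | true = s≤s z≤n
  ... | false = count-pos p x∈xs px

module _ {A B : Set} where

  count-map : (p : B → Bool) (f : A → B) (xs : List A) → count p (map f xs) ≡ count (p ∘ f) xs
  count-map p f [] = refl
  count-map p f (x ∷ xs) = cong ((if p (f x) then 1 else 0) ℕ.+_) (count-map p f xs)

size-halves : {n : ℕ} (W : VSet (suc n)) → size W ≡ size (W ∘ (false ∷_)) ℕ.+ size (W ∘ (true ∷_))
size-halves {n} W = trans (count-++ W (map (false ∷_) (allV n)) (map (true ∷_) (allV n)))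
  (cong₂ ℕ._+_ (count-map W (false ∷_) (allV n)) (count-map W (true ∷_) (allV n)))

size+size-compl : {n : ℕ} (W : VSet n) → size W ℕ.+ size (compl W) ≡ 2 ^ n
size+size-compl {n} W = trans (count+count-not W (allV n)) (length-allV n)
  where
  length-allV : ∀ n → length (allV n) ≡ 2 ^ n
  length-allV zero = refl
  length-allV (suc n) = begin
    length (map (false ∷_) (allV n) ++ map (true ∷_) (allV n))  ≡⟨ ListP.length-++ (map (false ∷_) (allV n)) ⟩
    length (map (false ∷_) (allV n)) ℕ.+ length (map (true ∷_) (allV n))
                                              ≡⟨ cong₂ ℕ._+_ (ListP.length-map _ (allV n)) (ListP.length-map _ (allV n)) ⟩
    length (allV n) ℕ.+ length (allV n)       ≡⟨ cong (λ m → m ℕ.+ m) (length-allV n) ⟩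
    2 ^ n ℕ.+ 2 ^ n                           ≡⟨ cong (2 ^ n ℕ.+_) (sym (ℕP.+-identityʳ (2 ^ n))) ⟩
    2 ^ suc n                                 ∎
    where open ≡-Reasoning

size≤2^n : {n : ℕ} (W : VSet n) → size W ≤ 2 ^ n
size≤2^n W = subst (size W ≤_) (size+size-compl W) (ℕP.m≤m+n (size W) _)

pigeonhole : {n : ℕ} (A B : VSet n) → 2 ^ n < size A ℕ.+ size B → ∃ λ v → A v ≡ true × B v ≡ true
pigeonhole {n} A B crowded with search (λ v → A v ∧ B v)
... | inj₁ (v , e) = v , ∧-true e
... | inj₂ disjoint = ⊥-elim (ℕP.<⇒≱ crowded (begin
  size A ℕ.+ size B            ≤⟨ ℕP.+-monoʳ-≤ (size A) (count-mono (allV n) B⊆compl-A) ⟩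
  size A ℕ.+ size (compl A)    ≡⟨ size+size-compl A ⟩
  2 ^ n                        ∎))
  where
  open ℕP.≤-Reasoning
  B⊆compl-A : ∀ v → B v ≡ true → compl A v ≡ true
  B⊆compl-A v Bv = cong not (trans (sym (BoolP.∧-identityʳ (A v))) (subst (λ b → A v ∧ b ≡ false) Bv (disjoint v)))

adj-same-half : {n : ℕ} (b : Bool) (u w : V n) → adj (b ∷ u) (b ∷ w) ≡ adj u w
adj-same-half false u w = refl
adj-same-half true u w = refl

≟V-same-half : {n : ℕ} (b : Bool) (u w : V n) → (b ∷ u) ≟V (b ∷ w) ≡ u ≟V w
≟V-same-half false u w = refl
≟V-same-half true u w = refl

adj-other-half : {n : ℕ} (b : Bool) (u w : V n) → adj (b ∷ u) (not b ∷ w) ≡ w ≟V u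
adj-other-half b u w = trans (hamming-step b) (hamming≡0 u w)
  where
  hamming-step : ∀ b → adj (b ∷ u) (not b ∷ w) ≡ (hamming u w ℕ.≡ᵇ 0)
  hamming-step false = refl
  hamming-step true = refl
  hamming≡0 : {n : ℕ} (u w : V n) → (hamming u w ℕ.≡ᵇ 0) ≡ (w ≟V u)
  hamming≡0 [] [] = refl
  hamming≡0 (false ∷ u) (false ∷ w) = hamming≡0 u w
  hamming≡0 (true ∷ u) (true ∷ w) = hamming≡0 u w
  hamming≡0 (false ∷ u) (true ∷ w) = refl
  hamming≡0 (true ∷ u) (false ∷ w) = refl

count-≟V : {n : ℕ} (v : V n) → count (_≟V v) (allV n) ≡ 1
count-≟V {n} v = ℤP.+-injective (trans (count≡∑ind (_≟V v) (allV n)) (trans (∑-cong (allV n) ind≡) (∑V-point v (+ 1))))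
  where
  ind≡ : ∀ u → ind (u ≟V v) ≡ (if u ≟V v then + 1 else +0)
  ind≡ u with u ≟V v
  ... | true = refl
  ... | false = refl

val≡n : {n : ℕ} (v : V n) → val v ≡ n
val≡n [] = refl
val≡n {suc n} (b ∷ v) = begin
  val (b ∷ v)                                                         ≡⟨ size-halves (adj (b ∷ v)) ⟩
  count (adj (b ∷ v) ∘ (false ∷_)) (allV n) ℕ.+ count (adj (b ∷ v) ∘ (true ∷_)) (allV n)
                                                                      ≡⟨ halves b ⟩
  count (adj v) (allV n) ℕ.+ count (_≟V v) (allV n)                   ≡⟨ cong₂ ℕ._+_ (val≡n v) (count-≟V v) ⟩
  n ℕ.+ 1                                                             ≡⟨ ℕP.+-comm n 1 ⟩
  suc n                                                               ∎
  where
  open ≡-Reasoning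
  halves : ∀ b → count (adj (b ∷ v) ∘ (false ∷_)) (allV n) ℕ.+ count (adj (b ∷ v) ∘ (true ∷_)) (allV n)
                 ≡ count (adj v) (allV n) ℕ.+ count (_≟V v) (allV n)
  halves false = cong₂ ℕ._+_ (count-cong (allV n) (adj-same-half false v)) (count-cong (allV n) (adj-other-half false v))
  halves true = trans (ℕP.+-comm (count (adj (true ∷ v) ∘ (false ∷_)) (allV n)) _)
    (cong₂ ℕ._+_ (count-cong (allV n) (adj-same-half true v)) (count-cong (allV n) (adj-other-half true v)))

⊆-size-≥ : {n : ℕ} {E A : VSet n} → E ⊆ A → size A ≤ size E → ∀ v → A v ≡ E v
⊆-size-≥ {n} {E} {A} E⊆A |A|≤|E| v with A v in Av | E v in Ev
... | false | false = refl
... | false | true = trans (sym Av) (E⊆A v Ev)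
... | true | true = refl
... | true | false = ⊥-elim (ℕP.<⇒≱ |E|<|A| |A|≤|E|)
  where
  A∧E≡E : count (λ x → A x ∧ E x) (allV n) ≡ size E
  A∧E≡E = count-cong (allV n) λ x → absorb (A x) (E x) (E⊆A x)
    where
    absorb : ∀ a e → (e ≡ true → a ≡ true) → (a ∧ e) ≡ e
    absorb true e _ = refl
    absorb false true e⇒a = e⇒a refl
    absorb false false _ = refl
  |E|<|A| : size E < size A
  |E|<|A| = begin-strict
    size E                                                    <⟨ ℕP.m<m+n (size E) ℕP.0<1+n ⟩
    size E ℕ.+ 1                                              ≤⟨ ℕP.+-mono-≤ (ℕP.≤-reflexive (sym A∧E≡E))
                                                                   (count-pos (λ x → A x ∧ not (E x)) (∈allV v) (cong₂ _∧_ Av (cong not Ev))) ⟩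
    count (λ x → A x ∧ E x) (allV n) ℕ.+ count (λ x → A x ∧ not (E x)) (allV n) ≡⟨ sym (count-split A E (allV n)) ⟩
    size A                                                    ∎
    where open ℕP.≤-Reasoning

-- Parity, and a divisor of degree 16 and positive rank

parity : {n : ℕ} → V n → Bool
parity [] = false
parity (x ∷ v) = x xor parity v

odd? : ℕ → Bool
odd? zero = false
odd? (suc n) = not (odd? n)

parity-hamming : {n : ℕ} (u w : V n) → parity u xor parity w ≡ odd? (hamming u w)
parity-hamming [] [] = refl
parity-hamming (false ∷ u) (false ∷ w) = parity-hamming u w
parity-hamming (true ∷ u) (true ∷ w) = trans (flip-both (parity u) (parity w)) (parity-hamming u w)
  where
  flip-both : ∀ a b → not a xor not b ≡ a xor b
  flip-both false b = BoolP.not-involutive b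
  flip-both true b = refl
parity-hamming (false ∷ u) (true ∷ w) = trans (flip-right (parity u) (parity w)) (cong not (parity-hamming u w))
  where
  flip-right : ∀ a b → a xor not b ≡ not (a xor b)
  flip-right false b = refl
  flip-right true b = refl
parity-hamming (true ∷ u) (false ∷ w) = trans (flip-left (parity u) (parity w)) (cong not (parity-hamming u w))
  where
  flip-left : ∀ a b → not a xor b ≡ not (a xor b)
  flip-left false b = refl
  flip-left true b = sym (BoolP.not-involutive b)

adj-flips-parity : {n : ℕ} {u w : V n} → adj u w ≡ true → parity w ≡ not (parity u)
adj-flips-parity {u = u} {w} u~w with ℕP.≡ᵇ⇒≡ (hamming u w) 1 (subst T (sym u~w) tt)
... | d≡1 = xor-true (parity u) (parity w) (trans (parity-hamming u w) (cong odd? d≡1))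
  where
  xor-true : ∀ a b → a xor b ≡ true → b ≡ not a
  xor-true false b e = e
  xor-true true b e = trans (sym (BoolP.not-involutive b)) (cong not e)

chipsOnEven : Divisor 5
chipsOnEven v = if parity v then +0 else + 1

deg-chipsOnEven : deg chipsOnEven ≡ + 16
deg-chipsOnEven = refl

chipsOnEven-effective : Effective chipsOnEven
chipsOnEven-effective w with parity w
... | true = ℤP.≤-refl
... | false = ℤ.+≤+ z≤n

odd-recovers : ∀ q → parity q ≡ true → Effective (fireAll (allBut q) (minusChip chipsOnEven q))
odd-recovers q odd w = subst (+0 ≤ℤ_) (sym (fireAll-allBut q (minusChip chipsOnEven q) w)) (recovered w)
  where
  recovered : ∀ w → +0 ≤ℤ minusChip chipsOnEven q w + Δ (δ q) w
  recovered w with w ≟V q in w≟q | Δδ-at q w | Δδ-other q w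
  ... | true | Δδ-w | _ rewrite ≟V-sound {u = w} w≟q | odd | Δδ-w refl | val≡n q = ℤ.+≤+ z≤n
  ... | false | _ | Δδ-w rewrite Δδ-w refl with adj q w in q~w
  ...   | false = subst (+0 ≤ℤ_) (sym (ℤP.+-identityʳ _)) (chipsOnEven-effective w)
  ...   | true rewrite trans (adj-flips-parity {u = q} q~w) (cong not odd) = ℤP.≤-refl

minusChip-effective : ∀ q → parity q ≡ false → Effective (minusChip chipsOnEven q)
minusChip-effective q even w with w ≟V q in w≟q
... | true rewrite ≟V-sound {u = w} w≟q | even = ℤP.≤-refl
... | false = chipsOnEven-effective w

chipsOnEven-positiveRank : PositiveRank chipsOnEven
chipsOnEven-positiveRank q with parity q in q-parity
... | true = fireAll (allBut q) (minusChip chipsOnEven q) , odd-recovers q q-parity , fireAll-∼ (allBut q) (minusChip chipsOnEven q)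
... | false = minusChip chipsOnEven q , minusChip-effective q q-parity , ε

-- Harper's edge-isoperimetric bound on Q_n for n ≤ 5

-- Twice the maximal number of edges induced by m vertices of a cube, namely
-- 2 ∑_{i<m} (number of ones in the binary expansion of i).
maxInner : ℕ → ℕ
maxInner m = fromMaybe 0 (head (drop m table))
  where
  table : List ℕ
  table = 0 ∷ 0 ∷ 2 ∷ 4 ∷ 8 ∷ 10 ∷ 14 ∷ 18 ∷ 24 ∷ 26 ∷ 30 ∷ 34 ∷ 40 ∷ 44 ∷ 50 ∷ 56 ∷ 64 ∷
          66 ∷ 70 ∷ 74 ∷ 80 ∷ 84 ∷ 90 ∷ 96 ∷ 104 ∷ 108 ∷ 114 ∷ 120 ∷ 128 ∷ 134 ∷ 142 ∷ 150 ∷ 160 ∷ []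

maxInner-merge : ∀ {a} → a < 17 → ∀ {b} → b < 17 → ∀ {m} → m < 17 → m ≤ a → m ≤ b →
                 maxInner a ℕ.+ maxInner b ℕ.+ 2 * m ≤ maxInner (a ℕ.+ b)
maxInner-merge = from-yes (ℕP.allUpTo? (λ a → ℕP.allUpTo? (λ b → ℕP.allUpTo? (λ m →
  m ℕP.≤? a →-dec m ℕP.≤? b →-dec maxInner a ℕ.+ maxInner b ℕ.+ 2 * m ℕP.≤? maxInner (a ℕ.+ b)) 17) 17) 17)

-- Twice the number of edges induced by A.
inner : {n : ℕ} → VSet n → ℤ
inner A = ∑V (λ u → ∑V (λ w → ind (A u ∧ A w ∧ adj u w)))

module _ {n : ℕ} (A : VSet (suc n)) where

  private
    A₀ A₁ : VSet n
    A₀ = A ∘ (false ∷_)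
    A₁ = A ∘ (true ∷_)

    partner : (P : Bool) (Q : VSet n) (b : Bool) (u : V n) →
              ∑V (λ w → ind (P ∧ Q w ∧ adj (b ∷ u) (not b ∷ w))) ≡ ind (P ∧ Q u)
    partner P Q b u = trans (∑-cong (allV n) term) (∑V-point u _)
      where
      term : ∀ w → ind (P ∧ Q w ∧ adj (b ∷ u) (not b ∷ w)) ≡ (if w ≟V u then ind (P ∧ Q u) else +0)
      term w rewrite adj-other-half b u w with w ≟V u in e
      ... | true rewrite ≟V-sound {u = w} e = cong ind (cong (P ∧_) (BoolP.∧-identityʳ (Q u)))
      ... | false = cong ind (trans (cong (P ∧_) (BoolP.∧-zeroʳ (Q w))) (BoolP.∧-zeroʳ P))

  common : ℕ
  common = count (λ u → A₀ u ∧ A₁ u) (allV n)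

  inner-halves : inner A ≡ (inner A₀ + inner A₁) + (+ common + + common)
  inner-halves = begin
    inner A                                                   ≡⟨ ∑V-halves row ⟩
    ∑V (row ∘ (false ∷_)) + ∑V (row ∘ (true ∷_))              ≡⟨ cong₂ _+_ (∑-cong (allV n) row₀) (∑-cong (allV n) row₁) ⟩
    ∑V (λ u → in₀ u + both₀ u) + ∑V (λ u → both₁ u + in₁ u)   ≡⟨ cong₂ _+_ (∑-+ (allV n) in₀ both₀) (∑-+ (allV n) both₁ in₁) ⟩
    (inner A₀ + ∑V both₀) + (∑V both₁ + inner A₁)             ≡⟨ cong₂ (λ x y → (inner A₀ + x) + (y + inner A₁)) common₀ common₁ ⟩
    (inner A₀ + + common) + (+ common + inner A₁)             ≡⟨ regroup (inner A₀) (+ common) (+ common) (inner A₁) ⟩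
    (inner A₀ + inner A₁) + (+ common + + common)             ∎
    where
    open ≡-Reasoning
    row : V (suc n) → ℤ
    row x = ∑V (λ y → ind (A x ∧ A y ∧ adj x y))
    in₀ in₁ both₀ both₁ : V n → ℤ
    in₀ u = ∑V (λ w → ind (A₀ u ∧ A₀ w ∧ adj u w))
    in₁ u = ∑V (λ w → ind (A₁ u ∧ A₁ w ∧ adj u w))
    both₀ u = ind (A₀ u ∧ A₁ u)
    both₁ u = ind (A₁ u ∧ A₀ u)
    row₀ : ∀ u → row (false ∷ u) ≡ in₀ u + both₀ u
    row₀ u = trans (∑V-halves (λ y → ind (A₀ u ∧ A y ∧ adj (false ∷ u) y))) (cong (_+_ (in₀ u)) (partner (A₀ u) A₁ false u))
    row₁ : ∀ u → row (true ∷ u) ≡ both₁ u + in₁ u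
    row₁ u = trans (∑V-halves (λ y → ind (A₁ u ∧ A y ∧ adj (true ∷ u) y))) (cong (_+ in₁ u) (partner (A₁ u) A₀ true u))
    common₀ : ∑V both₀ ≡ + common
    common₀ = sym (count≡∑ind _ (allV n))
    common₁ : ∑V both₁ ≡ + common
    common₁ = trans (∑-cong (allV n) (λ u → cong ind (BoolP.∧-comm (A₁ u) (A₀ u)))) common₀
    regroup : ∀ a b c d → (a + b) + (c + d) ≡ (a + d) + (b + c)
    regroup = solve-∀

harper : ∀ {n} → n ≤ 5 → (A : VSet n) → inner A ≤ℤ + maxInner (size A)
harper {zero} _ A with A []
... | true = ℤ.+≤+ z≤n
... | false = ℤ.+≤+ z≤n
harper {suc m} (s≤s m≤4) A = begin
  inner A                                              ≡⟨ inner-halves A ⟩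
  (inner A₀ + inner A₁) + (+ c + + c)                  ≤⟨ ℤP.+-monoˡ-≤ (+ c + + c) (ℤP.+-mono-≤ (harper m≤5 A₀) (harper m≤5 A₁)) ⟩
  (+ maxInner a₀ + + maxInner a₁) + (+ c + + c)        ≡⟨ as-ℕ (maxInner a₀) (maxInner a₁) c ⟩
  + (maxInner a₀ ℕ.+ maxInner a₁ ℕ.+ 2 * c)            ≤⟨ ℤ.+≤+ (maxInner-merge (small A₀) (small A₁) (ℕP.≤-<-trans c≤a₀ (small A₀)) c≤a₀ c≤a₁) ⟩
  + maxInner (a₀ ℕ.+ a₁)                               ≡⟨ cong (+_ ∘ maxInner) (sym (size-halves A)) ⟩
  + maxInner (size A)                                  ∎
  where
  open ℤP.≤-Reasoning
  m≤5 : m ≤ 5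
  m≤5 = ℕP.m≤n⇒m≤1+n m≤4
  A₀ A₁ : VSet m
  A₀ = A ∘ (false ∷_)
  A₁ = A ∘ (true ∷_)
  a₀ a₁ c : ℕ
  a₀ = size A₀
  a₁ = size A₁
  c = common A
  small : (W : VSet m) → size W < 17
  small W = s≤s (ℕP.≤-trans (size≤2^n W) (ℕP.^-monoʳ-≤ 2 m≤4))
  c≤a₀ : c ≤ a₀
  c≤a₀ = count-mono (allV m) λ u e → proj₁ (∧-true e)
  c≤a₁ : c ≤ a₁
  c≤a₁ = count-mono (allV m) λ u e → proj₂ (∧-true {A₀ u} e)
  as-ℕ : ∀ x y z → (+ x + + y) + (+ z + + z) ≡ + (x ℕ.+ y ℕ.+ 2 * z)
  as-ℕ x y z rewrite ℕP.+-identityʳ z = sym (trans (ℤP.pos-+ (x ℕ.+ y) (z ℕ.+ z)) (cong₂ _+_ (ℤP.pos-+ x y) (ℤP.pos-+ z z)))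

cutSize+inner : {n : ℕ} (A : VSet n) → + cutSize A + inner A ≡ + (n * size A)
cutSize+inner {n} A = begin
  + cutSize A + inner A                                   ≡⟨ cong (_+ inner A) (cutSize≡∑ A) ⟩
  ∑V (leaving) + inner A                                  ≡⟨ sym (∑-+ (allV n) leaving _) ⟩
  ∑V (λ u → leaving u + ∑V (λ w → ind (A u ∧ A w ∧ adj u w)))  ≡⟨ ∑-cong (allV n) per-vertex ⟩
  ∑V (λ u → if A u then + n else +0)                      ≡⟨ ∑-if-const (allV n) ⟩
  + (n * size A)                                          ∎
  where
  open ≡-Reasoning
  leaving : V n → ℤ
  leaving u = ∑V (λ w → ind (A u ∧ not (A w) ∧ adj u w))
  split : ∀ a b c → ind (a ∧ not b ∧ c) + ind (a ∧ b ∧ c) ≡ (if a then ind c else +0)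
  split true true true = refl
  split true true false = refl
  split true false true = refl
  split true false false = refl
  split false b c = refl
  per-vertex : ∀ u → leaving u + ∑V (λ w → ind (A u ∧ A w ∧ adj u w)) ≡ (if A u then + n else +0)
  per-vertex u = trans (sym (∑-+ (allV n) _ _)) (trans (∑-cong (allV n) (λ w → split (A u) (A w) (adj u w))) by-valence)
    where
    by-valence : ∑V (λ w → if A u then ind (adj u w) else +0) ≡ (if A u then + n else +0)
    by-valence with A u
    ... | true = trans (sym (count≡∑ind (adj u) (allV n))) (cong +_ (val≡n u))
    ... | false = ∑-zero (allV n)
  ∑-if-const : (xs : List (V n)) → ∑ xs (λ u → if A u then + n else +0) ≡ + (n * count A xs)
  ∑-if-const [] = cong +_ (sym (ℕP.*-zeroʳ n))
  ∑-if-const (x ∷ xs) with A x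
  ... | true = trans (cong (_+_ (+ n)) (∑-if-const xs)) (trans (sym (ℤP.pos-+ n _)) (cong +_ (sym (ℕP.*-suc n _))))
  ... | false = trans (ℤP.+-identityˡ _) (∑-if-const xs)

cutSize-compl : {n : ℕ} (A : VSet n) → cutSize (compl A) ≡ cutSize A
cutSize-compl {n} A = ℤP.+-injective (trans (cutSize≡∑ (compl A)) (trans (∑-swap (allV n) (allV n) _)
  (trans (∑-cong (allV n) (λ u → ∑-cong (allV n) (λ w → cong ind (swap (A w) (A u) (adj-sym w u))))) (sym (cutSize≡∑ A)))))
  where
  swap : ∀ a b {c d} → c ≡ d → (not a ∧ not (not b) ∧ c) ≡ (b ∧ not a ∧ d)
  swap true b refl = sym (BoolP.∧-zeroʳ b)
  swap false true refl = refl
  swap false false refl = refl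

cutSize-cong : {n : ℕ} {A B : VSet n} → (∀ v → A v ≡ B v) → cutSize A ≡ cutSize B
cutSize-cong {n} {A} {B} A≡B = ℤP.+-injective (trans (cutSize≡∑ A) (trans
  (∑-cong (allV n) (λ u → ∑-cong (allV n) (λ w → cong ind (cong₂ (λ x y → x ∧ not y ∧ adj u w) (A≡B u) (A≡B w)))))
  (sym (cutSize≡∑ B))))

cutSize≥16 : (A : VSet 5) → 6 ≤ size A → size A ≤ 16 → 16 ≤ cutSize A
cutSize≥16 A 6≤a a≤16 = ℕP.+-cancelʳ-≤ (maxInner a) 16 (cutSize A) (ℤP.drop‿+≤+ (begin
  + (16 ℕ.+ maxInner a)           ≤⟨ ℤ.+≤+ (enough (s≤s a≤16) 6≤a) ⟩
  + (5 * a)                       ≡⟨ sym (cutSize+inner A) ⟩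
  + cutSize A + inner A           ≤⟨ ℤP.+-monoʳ-≤ (+ cutSize A) (harper ℕP.≤-refl A) ⟩
  + cutSize A + + maxInner a      ≡⟨ sym (ℤP.pos-+ (cutSize A) (maxInner a)) ⟩
  + (cutSize A ℕ.+ maxInner a)    ∎))
  where
  open ℤP.≤-Reasoning
  a : ℕ
  a = size A
  enough : ∀ {a} → a < 17 → 6 ≤ a → 16 ℕ.+ maxInner a ≤ 5 * a
  enough = from-yes (ℕP.allUpTo? (λ a → 6 ℕP.≤? a →-dec 16 ℕ.+ maxInner a ℕP.≤? 5 * a) 17)

-- The scramble of order 16

IsStar : {n : ℕ} → VSet n → Set
IsStar E = size E ≡ 5 × ∃ λ c → E c ≡ true × ∀ u → E u ≡ true → (u ≡ c) ⊎ (adj c u ≡ true)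

IsEgg : {n : ℕ} → VSet n → Set
IsEgg E = InducesConnected E × Nonempty E × (6 ≤ size E ⊎ IsStar E)

-- A star induces only its four edges: two leaves have the same parity, so they are not adjacent.
inner-star : {n : ℕ} (E : VSet n) → IsStar E → inner E ≤ℤ + 8
inner-star {n} E (size≡5 , c , Ec , leaf-or-centre) = begin
  inner E                                      ≤⟨ ∑-mono (allV n) per-vertex ⟩
  ∑V (λ u → ind (E u) + (if u ≟V c then + 3 else +0))
                                               ≡⟨ ∑-+ (allV n) _ _ ⟩
  ∑V (ind ∘ E) + ∑V (λ u → if u ≟V c then + 3 else +0)
                                               ≡⟨ cong₂ _+_ (trans (sym (count≡∑ind E (allV n))) (cong +_ size≡5)) (∑V-point c (+ 3)) ⟩
  + 8                                          ∎
  where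
  open ℤP.≤-Reasoning
  ind≤1 : ∀ b → ind b ≤ℤ + 1
  ind≤1 true = ℤP.≤-refl
  ind≤1 false = ℤ.+≤+ z≤n
  leaves-nonadjacent : ∀ {u w} → adj c u ≡ true → adj c w ≡ true → adj u w ≡ true → ⊥
  leaves-nonadjacent {u} {w} c~u c~w u~w = BoolP.not-¬
    (trans (adj-flips-parity {u = c} c~w) (sym (adj-flips-parity {u = c} c~u))) (adj-flips-parity {u = u} u~w)
  centre : ∑V (λ w → ind (E c ∧ E w ∧ adj c w)) ≤ℤ + 4
  centre = ℤP.≤-trans (∑-mono (allV n) term) (ℤP.≤-reflexive leaves)
    where
    term : ∀ w → ind (E c ∧ E w ∧ adj c w) ≤ℤ ind (E w) - (if w ≟V c then + 1 else +0)
    term w with w ≟V c in e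
    ... | true rewrite ≟V-sound {u = w} e | Ec | adj-irrefl c = ℤ.+≤+ z≤n
    ... | false rewrite Ec with E w | adj c w
    ...   | true | true = ℤP.≤-refl
    ...   | true | false = ℤ.+≤+ z≤n
    ...   | false | _ = ℤP.≤-refl
    leaves : ∑V (λ w → ind (E w) - (if w ≟V c then + 1 else +0)) ≡ + 4
    leaves = trans (∑-+ (allV n) (ind ∘ E) _) (cong₂ _+_ (trans (sym (count≡∑ind E (allV n))) (cong +_ size≡5))
                                                       (trans (∑-neg (allV n) _) (cong -_ (∑V-point c (+ 1)))))
  leaf : ∀ u → u ≟V c ≡ false → ∑V (λ w → ind (E u ∧ E w ∧ adj u w)) ≤ℤ ind (E u)
  leaf u u≢c with E u in Eu
  ... | false = ℤP.≤-reflexive (∑-zero (allV n))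
  ... | true = ℤP.≤-trans (∑-mono (allV n) term) (ℤP.≤-reflexive (∑V-point c (+ 1)))
    where
    c~u : adj c u ≡ true
    c~u with leaf-or-centre u Eu
    ... | inj₁ refl with () ← trans (sym (≟V-refl c)) u≢c
    ... | inj₂ c~u = c~u
    term : ∀ w → ind (E w ∧ adj u w) ≤ℤ (if w ≟V c then + 1 else +0)
    term w with w ≟V c in w≟c
    ... | true = ind≤1 (E w ∧ adj u w)
    ... | false with E w in Ew | adj u w in u~w
    ...   | false | _ = ℤP.≤-refl
    ...   | true | false = ℤP.≤-refl
    ...   | true | true with leaf-or-centre w Ew
    ...     | inj₁ refl with () ← trans (sym (≟V-refl c)) w≟c
    ...     | inj₂ c~w = ⊥-elim (leaves-nonadjacent c~u c~w u~w)
  per-vertex : ∀ u → ∑V (λ w → ind (E u ∧ E w ∧ adj u w)) ≤ℤ ind (E u) + (if u ≟V c then + 3 else +0)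
  per-vertex u with u ≟V c in e
  ... | true rewrite ≟V-sound {u = u} e = ℤP.≤-trans centre (ℤP.≤-reflexive (cong (λ b → ind b + + 3) (sym Ec)))
  ... | false = ℤP.≤-trans (leaf u e) (ℤP.≤-reflexive (sym (ℤP.+-identityʳ _)))

cutSize-star : (E : VSet 5) → IsStar E → 17 ≤ cutSize E
cutSize-star E star = ℤP.drop‿+≤+ (begin
  + 17                       ≤⟨ ℤP.+-monoʳ-≤ (+ 25) (ℤP.neg-mono-≤ (inner-star E star)) ⟩
  + 25 - inner E             ≡⟨ cong (_- inner E) (sym (trans (cutSize+inner E) (cong (+_ ∘ (5 *_)) (proj₁ star)))) ⟩
  (+ cutSize E + inner E) - inner E ≡⟨ cancel (+ cutSize E) (inner E) ⟩
  + cutSize E                ∎)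
  where
  open ℤP.≤-Reasoning
  cancel : ∀ a i → (a + i) - i ≡ a
  cancel = solve-∀

egg-cut-bound : (A E : VSet 5) → IsEgg E → E ⊆ A → size A ≤ 16 → 16 ≤ cutSize A
egg-cut-bound A E (_ , _ , inj₁ 6≤|E|) E⊆A |A|≤16 = cutSize≥16 A (ℕP.≤-trans 6≤|E| (count-mono (allV 5) E⊆A)) |A|≤16
egg-cut-bound A E (_ , _ , inj₂ star) E⊆A |A|≤16 with 6 ℕP.≤? size A
... | yes 6≤|A| = cutSize≥16 A 6≤|A| |A|≤16
... | no 6≰|A| = ℕP.≤-trans (ℕP.n≤1+n 16) (subst (17 ≤_) (sym (cutSize-cong A≡E)) (cutSize-star E star))
  where
  A≡E : ∀ v → A v ≡ E v
  A≡E = ⊆-size-≥ E⊆A (subst (size A ≤_) (sym (proj₁ star)) (ℕP.≤-pred (ℕP.≰⇒> 6≰|A|)))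

elements : {n : ℕ} → List (V n) → VSet n
elements L v = any (v ≟V_) L

elements⇒∈ : {n : ℕ} (L : List (V n)) {v : V n} → elements L v ≡ true → v ∈ L
elements⇒∈ L {v} e = Any.map (≟V-sound ∘ T⇒≡) (any⁻ (v ≟V_) L (≡⇒T e))

∈⇒elements : {n : ℕ} (L : List (V n)) {v : V n} → v ∈ L → elements L v ≡ true
∈⇒elements L {v} v∈L = T⇒≡ (any⁺ (v ≟V_) (Any.map (λ { refl → ≡⇒T (≟V-refl v) }) v∈L))

attachesTo : {n : ℕ} → List (V n) → List (V n) → Bool
attachesTo seen [] = true
attachesTo seen (y ∷ ys) = any (adj y) seen ∧ attachesTo (y ∷ seen) ys

isConnectedOrder : {n : ℕ} → List (V n) → Bool
isConnectedOrder [] = true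
isConnectedOrder (x ∷ xs) = attachesTo (x ∷ []) xs

allDistinct : {n : ℕ} → List (V n) → Bool
allDistinct [] = true
allDistinct (x ∷ xs) = not (elements xs x) ∧ allDistinct xs

isStarList : {n : ℕ} → List (V n) → Bool
isStarList [] = false
isStarList (c ∷ leaves) = all (adj c) leaves

isEggList : {n : ℕ} → List (V n) → Bool
isEggList L = isConnectedOrder L ∧ allDistinct L ∧ ((6 ≤ᵇ length L) ∨ ((length L ≡ᵇ 5) ∧ isStarList L))

connectedOrder⇒connected : {n : ℕ} (L : List (V n)) → isConnectedOrder L ≡ true → InducesConnected (elements L)
connectedOrder⇒connected [] _ u v ()
connectedOrder⇒connected {n} (x₀ ∷ xs) ok u v Eu Ev =
  walk-++ (walk-reverse (from-x₀ (elements⇒∈ (x₀ ∷ xs) Eu))) (from-x₀ (elements⇒∈ (x₀ ∷ xs) Ev))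
  where
  E : VSet n
  E = elements (x₀ ∷ xs)
  reach : ∀ seen ys → attachesTo seen ys ≡ true → (∀ {s} → s ∈ seen → WalkIn E x₀ s) →
          (∀ {y} → y ∈ ys → y ∈ xs) → ∀ {y} → y ∈ ys → WalkIn E x₀ y
  reach seen (y ∷ ys) ok walks ys⊆xs {z} z∈ with ∧-true ok
  ... | attached , rest with any⁻ (adj y) seen (≡⇒T attached)
  ...   | y~seen with find y~seen
  ...     | s , s∈seen , y~s = continue z∈
    where
    to-y : WalkIn E x₀ y
    to-y = walk-snoc (walks s∈seen) (trans (adj-sym s y) (T⇒≡ y~s)) (∈⇒elements (x₀ ∷ xs) (there (ys⊆xs (here refl))))
    continue : ∀ {z} → z ∈ y ∷ ys → WalkIn E x₀ z
    continue (here refl) = to-y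
    continue (there z∈ys) = reach (y ∷ seen) ys rest (λ { (here refl) → to-y ; (there s∈) → walks s∈ })
                                  (ys⊆xs ∘ there) z∈ys
  from-x₀ : ∀ {y} → y ∈ x₀ ∷ xs → WalkIn E x₀ y
  from-x₀ (here refl) = stop (∈⇒elements (x₀ ∷ xs) (here refl))
  from-x₀ (there y∈xs) = reach (x₀ ∷ []) xs ok (λ { (here refl) → stop (∈⇒elements (x₀ ∷ xs) (here refl)) }) (λ y∈ → y∈) y∈xs

size-elements : {n : ℕ} (L : List (V n)) → allDistinct L ≡ true → size (elements L) ≡ length L
size-elements {n} [] _ = ℤP.+-injective (trans (count≡∑ind (elements []) (allV n)) (∑-zero (allV n)))
size-elements {n} (x ∷ L) distinct with ∧-true {not (elements L x)} distinct
... | x∉L , L-distinct = ℤP.+-injective (begin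
  + size (elements (x ∷ L))                                      ≡⟨ count≡∑ind _ (allV n) ⟩
  ∑V (ind ∘ elements (x ∷ L))                                    ≡⟨ ∑-cong (allV n) split ⟩
  ∑V (λ v → (if v ≟V x then + 1 else +0) + ind (elements L v))   ≡⟨ ∑-+ (allV n) _ _ ⟩
  ∑V (λ v → if v ≟V x then + 1 else +0) + ∑V (ind ∘ elements L)  ≡⟨ cong₂ _+_ (∑V-point x (+ 1)) (sym (count≡∑ind _ (allV n))) ⟩
  + 1 + + size (elements L)                                      ≡⟨ cong (λ m → + 1 + + m) (size-elements L L-distinct) ⟩
  + suc (length L)                                               ∎)
  where
  open ≡-Reasoning
  split : ∀ v → ind (elements (x ∷ L) v) ≡ (if v ≟V x then + 1 else +0) + ind (elements L v)
  split v with v ≟V x in v≟x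
  ... | false = sym (ℤP.+-identityˡ _)
  ... | true rewrite ≟V-sound {u = v} v≟x | BoolP.not-injective {y = false} x∉L = refl

eggList⇒egg : {n : ℕ} (L : List (V n)) → isEggList L ≡ true → IsEgg (elements L)
eggList⇒egg [] ()
eggList⇒egg {n} (x ∷ xs) ok with ∧-true ok
... | connected , rest with ∧-true rest
... | distinct , large =
  connectedOrder⇒connected (x ∷ xs) connected , (x , ∈⇒elements L (here refl)) , big (∨-true large)
  where
  L : List (V n)
  L = x ∷ xs
  |L| : size (elements L) ≡ length L
  |L| = size-elements L distinct
  big : ((6 ≤ᵇ length L) ≡ true) ⊎ (((length L ≡ᵇ 5) ∧ isStarList L) ≡ true) → 6 ≤ size (elements L) ⊎ IsStar (elements L)
  big (inj₁ e) = inj₁ (subst (6 ≤_) (sym |L|) (ℕP.≤ᵇ⇒≤ 6 (length L) (≡⇒T e)))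
  big (inj₂ e) with ∧-true e
  ... | five , star = inj₂ (trans |L| (ℕP.≡ᵇ⇒≡ (length L) 5 (≡⇒T five)) , x , ∈⇒elements L (here refl) , leaf-or-centre)
    where
    leaf-or-centre : ∀ u → elements L u ≡ true → (u ≡ x) ⊎ (adj x u ≡ true)
    leaf-or-centre u Lu with elements⇒∈ L {u} Lu
    ... | here refl = inj₁ refl
    ... | there u∈xs = inj₂ (all-sound (adj x) xs (≡⇒T star) u∈xs)

module _ {n : ℕ} (b : Bool) where

  private
    lift : V n → V (suc n)
    lift = b ∷_

    map-lift : {B : Set} (p : V (suc n) → B) (q : V n → B) → (∀ x → p (lift x) ≡ q x) →
               ∀ xs → map p (map lift xs) ≡ map q xs
    map-lift p q eq xs = trans (sym (ListP.map-∘ xs)) (ListP.map-cong eq xs)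

    elements-lift : ∀ L y → elements (map lift L) (lift y) ≡ elements L y
    elements-lift L y = cong or (map-lift (lift y ≟V_) (y ≟V_) (≟V-same-half b y) L)

    attachesTo-lift : ∀ seen ys → attachesTo (map lift seen) (map lift ys) ≡ attachesTo seen ys
    attachesTo-lift seen [] = refl
    attachesTo-lift seen (y ∷ ys) =
      cong₂ _∧_ (cong or (map-lift (adj (lift y)) (adj y) (adj-same-half b y) seen))
                (attachesTo-lift (y ∷ seen) ys)

    connectedOrder-lift : ∀ L → isConnectedOrder (map lift L) ≡ isConnectedOrder L
    connectedOrder-lift [] = refl
    connectedOrder-lift (x ∷ xs) = attachesTo-lift (x ∷ []) xs

    allDistinct-lift : ∀ L → allDistinct (map lift L) ≡ allDistinct L
    allDistinct-lift [] = refl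
    allDistinct-lift (x ∷ xs) = cong₂ _∧_ (cong not (elements-lift xs x)) (allDistinct-lift xs)

    starList-lift : ∀ L → isStarList (map lift L) ≡ isStarList L
    starList-lift [] = refl
    starList-lift (c ∷ leaves) = cong and (map-lift (adj (lift c)) (adj c) (adj-same-half b c) leaves)

  isEggList-lift : ∀ L → isEggList (map lift L) ≡ isEggList L
  isEggList-lift L rewrite connectedOrder-lift L | allDistinct-lift L | starList-lift L | ListP.length-map lift L = refl

EggListIn : {n : ℕ} → VSet n → Set
EggListIn {n} W = ∃ λ (L : List (V n)) → isEggList L ≡ true × (∀ {v} → v ∈ L → W v ≡ true)

eggListIn-lift : {n : ℕ} (W : VSet (suc n)) (b : Bool) → EggListIn (W ∘ (b ∷_)) → EggListIn W
eggListIn-lift W b (L , egg , L⊆W) = map (b ∷_) L , trans (isEggList-lift b L) egg , lifted ∘ ∈P.∈-map⁻ (b ∷_)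
  where
  lifted : ∀ {v} → (∃ λ x → x ∈ L × v ≡ b ∷ x) → W v ≡ true
  lifted (x , x∈L , refl) = L⊆W x∈L

eggListIn-cong : {n : ℕ} {W W′ : VSet n} → (∀ v → W v ≡ W′ v) → EggListIn W → EggListIn W′
eggListIn-cong W≡W′ (L , egg , inside) = L , egg , λ {v} v∈L → trans (sym (W≡W′ v)) (inside v∈L)

-- Vertex sets tabulated, so that all subsets of a small cube can be enumerated

Table : ℕ → Set
Table zero = Bool
Table (suc n) = Table n × Table n

lookupTable : {n : ℕ} → Table n → VSet n
lookupTable {zero} b [] = b
lookupTable {suc n} (t₀ , t₁) (false ∷ v) = lookupTable t₀ v
lookupTable {suc n} (t₀ , t₁) (true ∷ v) = lookupTable t₁ v

toTable : {n : ℕ} → VSet n → Table n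
toTable {zero} W = W []
toTable {suc n} W = toTable (W ∘ (false ∷_)) , toTable (W ∘ (true ∷_))

lookup-toTable : {n : ℕ} (W : VSet n) (v : V n) → lookupTable (toTable W) v ≡ W v
lookup-toTable {zero} W [] = refl
lookup-toTable {suc n} W (false ∷ v) = lookup-toTable (W ∘ (false ∷_)) v
lookup-toTable {suc n} W (true ∷ v) = lookup-toTable (W ∘ (true ∷_)) v

allTables : (n : ℕ) → List (Table n)
allTables zero = true ∷ false ∷ []
allTables (suc n) = cartesianProduct (allTables n) (allTables n)

∈allTables : {n : ℕ} (t : Table n) → t ∈ allTables n
∈allTables {zero} true = here refl
∈allTables {zero} false = there (here refl)
∈allTables {suc n} (t₀ , t₁) = ∈P.∈-cartesianProduct⁺ (∈allTables t₀) (∈allTables t₁)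

tableSize : {n : ℕ} → Table n → ℕ
tableSize t = size (lookupTable t)

tableSize-toTable : {n : ℕ} (W : VSet n) → tableSize (toTable W) ≡ size W
tableSize-toTable {n} W = count-cong (allV n) (lookup-toTable W)

eggListIn-toTable : {n : ℕ} (W : VSet n) → EggListIn (lookupTable (toTable W)) → EggListIn W
eggListIn-toTable W = eggListIn-cong (lookup-toTable W)

-- Searching for eggs; the searches are heuristics whose answers are checked by isEggList.

neighbours : {n : ℕ} → V n → List (V n)
neighbours [] = []
neighbours (x ∷ v) = (not x ∷ v) ∷ map (x ∷_) (neighbours v)

grow : {n : ℕ} → ℕ → VSet n → List (V n) → List (V n)
grow zero W L = L
grow (suc k) W L with findᵇ (λ y → W y ∧ not (elements L y)) (concatMap neighbours L)
... | just y = grow k W (L ++ y ∷ [])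
... | nothing = L

treeIn : {n : ℕ} → ℕ → VSet n → List (V n) → Maybe (List (V n))
treeIn k W [] = nothing
treeIn k W (x ∷ xs) with W x
... | false = treeIn k W xs
... | true with grow (k ∸ 1) W (x ∷ [])
...   | L = if k ≤ᵇ length L then just L else treeIn k W xs

starIn : {n : ℕ} → VSet n → Maybe (List (V n))
starIn {n} W with findᵇ (λ c → W c ∧ all W (neighbours c)) (allV n)
... | just c = just (c ∷ neighbours c)
... | nothing = nothing

certifies : {n : ℕ} → Table n → Maybe (List (V n)) → Bool
certifies t nothing = false
certifies t (just L) = isEggList L ∧ all (lookupTable t) L

certifies-sound : {n : ℕ} (t : Table n) (m : Maybe (List (V n))) → certifies t m ≡ true → EggListIn (lookupTable t)
certifies-sound t (just L) ok with ∧-true ok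
... | egg , inside = L , egg , all-sound (lookupTable t) L (≡⇒T inside)

eggIn⁴ : Table 4 → Maybe (List (V 4))
eggIn⁴ t with starIn (lookupTable t)
... | just L = just L
... | nothing = treeIn 6 (lookupTable t) (allV 4)

hasEgg⁴ : Table 4 → Bool
hasEgg⁴ t = certifies t (eggIn⁴ t)

certifiesTree5 : Table 3 → Maybe (List (V 3)) → Bool
certifiesTree5 t nothing = false
certifiesTree5 t (just L) = isConnectedOrder L ∧ allDistinct L ∧ (length L ≡ᵇ 5) ∧ all (lookupTable t) L

extend : Bool → List (V 3) → V 3 → List (V 4)
extend b L u = map (b ∷_) L ++ (not b ∷ u) ∷ []

extensionOK : List (V 3) → V 3 → Bool
extensionOK L u = not (elements L u) ∨ (isEggList (extend false L u) ∧ isEggList (extend true L u))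

extensionsAreEggs : Maybe (List (V 3)) → Bool
extensionsAreEggs nothing = false
extensionsAreEggs (just L) = all (extensionOK L) (allV 3)

partnerOK : Table 3 → Table 3 → Bool
partnerOK t t′ = (tableSize t′ <ᵇ 4) ∨ (5 <ᵇ tableSize t′) ∨ (hasEgg⁴ (t , t′) ∧ hasEgg⁴ (t′ , t))

partnersHaveEggs : Table 3 → Bool
partnersHaveEggs t = all (partnerOK t) (allTables 3)

tree5 : Table 3 → Maybe (List (V 3))
tree5 t = treeIn 5 (lookupTable t) (allV 3)

largeCertificate : Table 3 → Bool
largeCertificate t = (tableSize t <ᵇ 6) ∨ certifies t (treeIn 6 (lookupTable t) (allV 3))

fiveCertificate : Table 3 → Bool
fiveCertificate t = not (tableSize t ≡ᵇ 5) ∨ (certifiesTree5 t (tree5 t) ∧ extensionsAreEggs (tree5 t)) ∨ partnersHaveEggs t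

q3-certified : ∀ t → (largeCertificate t ∧ fiveCertificate t) ≡ true
q3-certified t = all-sound (λ t → largeCertificate t ∧ fiveCertificate t) (allTables 3) tt (∈allTables t)

eggIn-Q3 : (t : Table 3) → 6 ≤ tableSize t → EggListIn (lookupTable t)
eggIn-Q3 t 6≤|t| with ∨-true (proj₁ (∧-true (q3-certified t)))
... | inj₁ small = ⊥-elim (ℕP.<⇒≱ (<ᵇ⇒< small) 6≤|t|)
... | inj₂ found = certifies-sound t (treeIn 6 (lookupTable t) (allV 3)) found

arrange : {n : ℕ} → Bool → Table n → Table n → Table (suc n)
arrange false t t′ = t , t′
arrange true t t′ = t′ , t

lookup-arrange : {n : ℕ} (b : Bool) (t t′ : Table n) (v : V n) →
                 lookupTable (arrange b t t′) (b ∷ v) ≡ lookupTable t v ×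
                 lookupTable (arrange b t t′) (not b ∷ v) ≡ lookupTable t′ v
lookup-arrange false t t′ v = refl , refl
lookup-arrange true t t′ v = refl , refl

-- A set in Q₄ with five vertices in one half and four or five in the other: if the five contain a
-- tree L, some u in L has its partner in the other half (pigeonhole) and L with that partner is an
-- egg; otherwise the pair of halves is checked directly.
module _ (t t′ : Table 3) (five : tableSize t ≡ 5) (four≤ : 4 ≤ tableSize t′) (≤five : tableSize t′ ≤ 5) (b : Bool) where

  private
    W : VSet 4
    W = lookupTable (arrange b t t′)

    via-tree : (m : Maybe (List (V 3))) → (certifiesTree5 t m ∧ extensionsAreEggs m) ≡ true → EggListIn W
    via-tree (just L) ok with ∧-true ok
    ... | tree , extensions with ∧-true {isConnectedOrder L} tree
    ...   | _ , rest with ∧-true {allDistinct L} rest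
    ...     | distinct , rest′ with ∧-true {length L ≡ᵇ 5} rest′
    ...       | length≡5 , inside with pigeonhole (elements L) (lookupTable t′)
                  (subst (λ s → 8 < s ℕ.+ tableSize t′) (sym |L|) (ℕP.+-monoʳ-≤ 5 four≤))
      where
      |L| : size (elements L) ≡ 5
      |L| = trans (size-elements L distinct) (ℕP.≡ᵇ⇒≡ (length L) 5 (≡⇒T length≡5))
    ...         | u , u∈L , t′-u = extend b L u , pick b extension-ok , in-W
      where
      extension-ok : (isEggList (extend false L u) ∧ isEggList (extend true L u)) ≡ true
      extension-ok with ∨-true {not (elements L u)} (all-sound (extensionOK L) (allV 3) (≡⇒T extensions) (∈allV u))
      ... | inj₁ u∉L with () ← trans (sym u∉L) (cong not u∈L)
      ... | inj₂ both = both
      pick : ∀ b → (isEggList (extend false L u) ∧ isEggList (extend true L u)) ≡ true → isEggList (extend b L u) ≡ true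
      pick false = proj₁ ∘ ∧-true
      pick true = proj₂ ∘ ∧-true {isEggList (extend false L u)}
      in-W : ∀ {v} → v ∈ extend b L u → W v ≡ true
      in-W v∈ with ∈P.∈-++⁻ (map (b ∷_) L) v∈
      ... | inj₂ (here refl) = trans (proj₂ (lookup-arrange b t t′ u)) t′-u
      ... | inj₁ v∈L′ with ∈P.∈-map⁻ (b ∷_) v∈L′
      ...   | x , x∈L , refl = trans (proj₁ (lookup-arrange b t t′ x)) (all-sound (lookupTable t) L (≡⇒T inside) x∈L)

    via-partners : partnersHaveEggs t ≡ true → EggListIn W
    via-partners ok with ∨-true (all-sound (partnerOK t) (allTables 3) (≡⇒T ok) (∈allTables t′))
    ... | inj₁ small = ⊥-elim (ℕP.<⇒≱ (<ᵇ⇒< small) four≤)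
    ... | inj₂ rest with ∨-true rest
    ...   | inj₁ large = ⊥-elim (ℕP.<⇒≱ (<ᵇ⇒< large) ≤five)
    ...   | inj₂ both = certifies-sound (arrange b t t′) (eggIn⁴ (arrange b t t′)) (this-order b both)
      where
      this-order : ∀ b → (hasEgg⁴ (t , t′) ∧ hasEgg⁴ (t′ , t)) ≡ true → hasEgg⁴ (arrange b t t′) ≡ true
      this-order false = proj₁ ∘ ∧-true
      this-order true = proj₂ ∘ ∧-true {hasEgg⁴ (t , t′)}

  eggIn-Q4-five : EggListIn W
  eggIn-Q4-five with ∨-true (proj₂ (∧-true (q3-certified t)))
  ... | inj₁ not-five with () ← trans (sym not-five) (cong (λ s → not (s ≡ᵇ 5)) five)
  ... | inj₂ rest with ∨-true rest
  ...   | inj₁ tree = via-tree (tree5 t) tree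
  ...   | inj₂ partners = via-partners partners

five-and-four : ∀ {a b} → a ≤ 5 → b ≤ 5 → 9 ≤ a ℕ.+ b → (a ≡ 5 × 4 ≤ b) ⊎ (b ≡ 5 × 4 ≤ a)
five-and-four {a} {b} a≤5 b≤5 9≤a+b with a ℕP.≟ 5
... | yes refl = inj₁ (refl , ℕP.+-cancelˡ-≤ 5 4 b 9≤a+b)
... | no a≢5 = inj₂ (ℕP.≤-antisym b≤5 (ℕP.+-cancelˡ-≤ 4 5 b (ℕP.≤-trans 9≤a+b (ℕP.+-monoˡ-≤ b a≤4))) ,
                     ℕP.+-cancelʳ-≤ 5 4 a (ℕP.≤-trans 9≤a+b (ℕP.+-monoʳ-≤ a b≤5)))
  where
  a≤4 : a ≤ 4
  a≤4 = ℕP.≤-pred (ℕP.≤∧≢⇒< a≤5 a≢5)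

arrange-toTable : {n : ℕ} (W : VSet (suc n)) (b : Bool) →
                  arrange b (toTable (W ∘ (b ∷_))) (toTable (W ∘ (not b ∷_))) ≡ toTable W
arrange-toTable W false = refl
arrange-toTable W true = refl

eggIn-Q3-half : (W : VSet 4) (b : Bool) → 6 ≤ size (W ∘ (b ∷_)) → EggListIn W
eggIn-Q3-half W b 6≤ = eggListIn-lift W b (eggListIn-toTable (W ∘ (b ∷_))
  (eggIn-Q3 (toTable (W ∘ (b ∷_))) (subst (6 ≤_) (sym (tableSize-toTable (W ∘ (b ∷_)))) 6≤)))

eggIn-Q4-halves : (W : VSet 4) (b : Bool) → size (W ∘ (b ∷_)) ≡ 5 →
                  4 ≤ size (W ∘ (not b ∷_)) → size (W ∘ (not b ∷_)) ≤ 5 → EggListIn W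
eggIn-Q4-halves W b five four≤ ≤five = eggListIn-toTable W (subst (EggListIn ∘ lookupTable) (arrange-toTable W b)
  (eggIn-Q4-five (toTable (W ∘ (b ∷_))) (toTable (W ∘ (not b ∷_)))
    (trans (tableSize-toTable (W ∘ (b ∷_))) five)
    (subst (4 ≤_) (sym (tableSize-toTable (W ∘ (not b ∷_)))) four≤)
    (subst (_≤ 5) (sym (tableSize-toTable (W ∘ (not b ∷_)))) ≤five) b))

eggIn-Q4 : (W : VSet 4) → 9 ≤ size W → EggListIn W
eggIn-Q4 W 9≤|W| with 6 ℕP.≤? size (W ∘ (false ∷_)) | 6 ℕP.≤? size (W ∘ (true ∷_))
... | yes 6≤ | _ = eggIn-Q3-half W false 6≤
... | no _ | yes 6≤ = eggIn-Q3-half W true 6≤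
... | no 6≰₀ | no 6≰₁ with five-and-four (ℕP.≮⇒≥ 6≰₀) (ℕP.≮⇒≥ 6≰₁) (subst (9 ≤_) (size-halves W) 9≤|W|)
...   | inj₁ (five , four≤) = eggIn-Q4-halves W false five four≤ (ℕP.≮⇒≥ 6≰₁)
...   | inj₂ (five , four≤) = eggIn-Q4-halves W true five four≤ (ℕP.≮⇒≥ 6≰₀)

eggIn-Q5 : (W : VSet 5) → 17 ≤ size W → EggListIn W
eggIn-Q5 W 17≤|W| with 9 ℕP.≤? size (W ∘ (false ∷_))
... | yes 9≤ = eggListIn-lift W false (eggIn-Q4 _ 9≤)
... | no 9≰ = eggListIn-lift W true (eggIn-Q4 _ (ℕP.+-cancelˡ-≤ 8 9 _
                (ℕP.≤-trans (subst (17 ≤_) (size-halves W) 17≤|W|) (ℕP.+-monoˡ-≤ _ (ℕP.≮⇒≥ 9≰)))))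

scramble₁₆ : Scramble 5
scramble₁₆ = record { Egg = IsEgg ; eggNonempty = λ E egg → proj₁ (proj₂ egg) ; eggConnected = λ E egg → proj₁ egg }

large-complement : (C : VSet 5) → ¬ 16 ≤ size C → 17 ≤ size (compl C)
large-complement C 16≰|C| = ℕP.+-cancelˡ-≤ 15 17 _ (ℕP.≤-trans (ℕP.≤-reflexive (sym (size+size-compl C)))
                                                              (ℕP.+-monoˡ-≤ _ (ℕP.≮⇒≥ 16≰|C|)))

hitting-sets-large : ∀ C → Hits scramble₁₆ C → 16 ≤ size C
hitting-sets-large C hits with 16 ℕP.≤? size C
... | yes 16≤ = 16≤
... | no 16≰ with eggIn-Q5 (compl C) (large-complement C 16≰)
...   | L , egg-list , L⊆compl-C with hits (elements L) (eggList⇒egg L egg-list)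
...     | v , Cv , Lv with () ← trans (sym (cong not Cv)) (L⊆compl-C (elements⇒∈ L Lv))

egg-cuts-large : ∀ A → EggCut scramble₁₆ A → 16 ≤ cutSize A
egg-cuts-large A ((E₁ , egg₁ , E₁⊆A) , (E₂ , egg₂ , E₂⊆compl-A)) with size A ℕP.≤? 16
... | yes |A|≤16 = egg-cut-bound A E₁ egg₁ E₁⊆A |A|≤16
... | no |A|≰16 = subst (16 ≤_) (cutSize-compl A) (egg-cut-bound (compl A) E₂ egg₂ E₂⊆compl-A |compl-A|≤16)
  where
  |compl-A|≤16 : size (compl A) ≤ 16
  |compl-A|≤16 = ℕP.m≤n⇒m≤1+n (ℕP.+-cancelˡ-≤ 17 _ 15
    (ℕP.≤-trans (ℕP.+-monoˡ-≤ _ (ℕP.≰⇒> |A|≰16)) (ℕP.≤-reflexive (size+size-compl A))))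

order₁₆ : OrderAtLeast scramble₁₆ 16
order₁₆ = hitting-sets-large , egg-cuts-large

theorem3p15 : ScrambleNumberIs 5 16 × GonalityIs 5 16
theorem3p15 = ((scramble₁₆ , order₁₆) , no-order-17) ,
              ((chipsOnEven , chipsOnEven-positiveRank , deg-chipsOnEven) , gonality≥order scramble₁₆ order₁₆)
  where
  no-order-17 : ∀ S → ¬ OrderAtLeast S 17
  no-order-17 S order≥17 = ℕP.<-irrefl refl (ℤP.drop‿+≤+
    (subst (+ 17 ≤ℤ_) deg-chipsOnEven (gonality≥order S order≥17 chipsOnEven chipsOnEven-positiveRank)))
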